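{- Let $\mathcal P(z)=a_0z^m+a_1z^{m-1}+\cdots+a_{m-1}z+a_m$ be a polynomial of degree $m$ with complex coefficients, and set $a_j:=0$ whenever $j<0$ or $j>m$. Let $N\in\mathbb N$ satisfy $\varphi(N)\le m$. Then $\mathcal P(z)$ is divisible by the cyclotomic polynomial $\Phi_N(z)$ if and only if $$\sum_{d\mid N}\mu(d)\sum_{\substack{j\in\mathbb Z\\ j\equiv h-\sum_{p\mid d}\frac{N}{p}\ (\mathrm{mod}\ N)}} a_j=0$$ for every $h\in\{0,1,\ldots,N-1\}$. Moreover, when $N$ is even, it suffices that this identity holds for every $h\in\{0,1,\ldots,N/2-1\}$.
   Context: $\Phi_N(z)=\prod_{1\le j\le N,\ (j,N)=1}(z-e^{2\pi i j/N})$ is the $N$th cyclotomic polynomial, $\varphi$ is Euler's totient function and $\mu$ is the Möbius function. In the inner condition, $p$ ranges over the prime divisors of $d$, and the sum $\sum_{p\mid d}N/p$ is taken to be $0$ when $d=1$. -}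

module Defs where

open import Level using (_⊔_)
open import Algebra.Bundles using (CommutativeRing)
open import Data.Nat as ℕ using (ℕ; zero; suc; _<_; _≤_; NonZero)
open import Data.Nat.Divisibility using (_∣_; _∣?_)
open import Data.Nat.DivMod using (_/_; _%_)
open import Data.Nat.GCD using (gcd)
open import Data.Nat.Primality using (Prime; prime?)
open import Data.Nat.ListAction using (sum)
open import Data.Integer as ℤ using (ℤ; +_; -[1+_])
open import Data.Fin using (Fin; toℕ)
open import Data.List as List using (List; []; _∷_; upTo; allFin; filter; map; length; foldr)
open import Data.List.Relation.Unary.Any using (any?)
open import Data.Product using (Σ; _×_)
open import Relation.Nullary using (¬_; Dec; yes; no; does)
open import Relation.Nullary.Decidable using (_×-dec_)
open import Relation.Binary.PropositionalEquality using (_≡_)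

divisors : ℕ → List ℕ
divisors n = filter (λ d → d ∣? n) (map suc (upTo n))

-- the prime divisors of d, as a list of (pred p) so that division by p is
-- well-typed; primeDivs d = [ p ∈ {1..d} | p prime, p ∣ d ]
primeDivsPred : ℕ → List ℕ
primeDivsPred d = filter (λ k → prime? (suc k) ×-dec (suc k ∣? d)) (upTo d)

primeDivs : ℕ → List ℕ
primeDivs d = map suc (primeDivsPred d)

φ : ℕ → ℕ
φ n = length (filter (λ j → gcd j n ℕ.≟ 1) (map suc (upTo n)))

μ : ℕ → ℤ
μ d with any? (λ p → (p ℕ.* p) ∣? d) (primeDivs d)
... | yes _ = + 0
... | no _  = (ℤ.- ℤ.1ℤ) ℤ.^ length (primeDivs d)

shift : (N d : ℕ) → ℕ
shift N d = sum (map (λ k → N / suc k) (primeDivsPred d))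

module _ {c ℓ} (R : CommutativeRing c ℓ) where
  open CommutativeRing R

  ofℕ : ℕ → Carrier
  ofℕ zero    = 0#
  ofℕ (suc n) = 1# + ofℕ n

  ofℤ : ℤ → Carrier
  ofℤ (+ n)      = ofℕ n
  ofℤ -[1+ n ]   = - ofℕ (suc n)

  -- characteristic-zero fields (the role of ℂ)
  record IsCharZeroField : Set (c ⊔ ℓ) where
    field
      1≉0     : ¬ (1# ≈ 0#)
      inverse : ∀ x → ¬ (x ≈ 0#) → Σ Carrier (λ y → x * y ≈ 1#)
      char0   : ∀ n → ¬ (ofℕ (suc n) ≈ 0#)

  pow : Carrier → ℕ → Carrier
  pow x zero    = 1#
  pow x (suc n) = x * pow x n

  -- list of coefficients [c₀, c₁, …]  represents c₀ + c₁ z + c₂ z² + …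
  Poly : Set c
  Poly = List Carrier

  coeff : Poly → ℕ → Carrier
  coeff []       _       = 0#
  coeff (a ∷ p)  zero    = a
  coeff (a ∷ p)  (suc k) = coeff p k

  _+P_ : Poly → Poly → Poly
  []      +P q       = q
  (a ∷ p) +P []      = a ∷ p
  (a ∷ p) +P (b ∷ q) = (a + b) ∷ (p +P q)

  scale : Carrier → Poly → Poly
  scale a = map (a *_)

  _*P_ : Poly → Poly → Poly
  []      *P q = []
  (a ∷ p) *P q = scale a q +P (0# ∷ (p *P q))

  -- equality of polynomials: all coefficients agree (trailing zeros ignored)
  _≈P_ : Poly → Poly → Set ℓ
  p ≈P q = ∀ k → coeff p k ≈ coeff q k

  _∣P_ : Poly → Poly → Set (c ⊔ ℓ)
  f ∣P g = Σ Poly (λ q → g ≈P (f *P q))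

  IsPrimitiveRoot : ℕ → Carrier → Set ℓ
  IsPrimitiveRoot N ζ = (pow ζ N ≈ 1#) × (∀ k → 0 < k → k < N → ¬ (pow ζ k ≈ 1#))

  cyclotomic : (N : ℕ) → Carrier → Poly
  cyclotomic N ζ =
    foldr (λ j acc → ((- pow ζ j) ∷ 1# ∷ []) *P acc) (1# ∷ [])
          (filter (λ j → gcd j N ℕ.≟ 1) (map suc (upTo N)))

  -- 𝒫(z) = a₀ z^m + a₁ z^(m-1) + ⋯ + a_m, from a : Fin (suc m) → K
  polyOf : (m : ℕ) → (Fin (suc m) → Carrier) → Poly
  polyOf m a = List.reverse (map a (allFin (suc m)))

  sumK : List Carrier → Carrier
  sumK = foldr _+_ 0#

  -- Σ_{j ∈ ℤ, j ≡ h − s (mod N)} a_j   with a_j = 0 outside 0..m;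
  -- j ≡ h − s (mod N) with 0 ≤ h < N is written (j + s) mod N = h
  congSum : (m N : ℕ) .{{_ : NonZero N}} → (Fin (suc m) → Carrier) → (s h : ℕ) → Carrier
  congSum m N a s h =
    sumK (map a (filter (λ j → ((toℕ j ℕ.+ s) % N) ℕ.≟ h) (allFin (suc m))))

  criterion : (m N : ℕ) .{{_ : NonZero N}} → (Fin (suc m) → Carrier) → ℕ → Carrier
  criterion m N a h =
    sumK (map (λ d → ofℤ (μ d) * congSum m N a (shift N d) h) (divisors N))

-- Φ_N is the product of the pairwise distinct linear factors z − ζᵏ with gcd(k, N) = 1, so Φ_N ∣ P
-- iff P(ζᵏ) = 0 for all those k, i.e. iff the reciprocal polynomial Q(z) = Σ aⱼ zʲ vanishes at every
-- primitive N-th root of unity ζᵗ. Write c_h for the left-hand side of the criterion. Its discrete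
-- Fourier transform at ζᵗ factors as W(ζᵗ) · Q(ζᵗ), where
--   W(v) = Σ_{d ∣ N} μ(d) v^{Σ_{p ∣ d} N/p} = ∏_{p ∣ N} (1 − v^{N/p}),
-- and W(ζᵗ) vanishes exactly when gcd(t, N) > 1. By Fourier inversion, all c_h vanish iff Q(ζᵗ) = 0 for
-- every t coprime to N. For even N only odd t contribute, and ζ^{tN/2} = −1 for them, so
-- c_{h+N/2} = −c_h and half of the conditions suffice.

module Submission where

open import Defs
open import Algebra.Bundles using (CommutativeRing; CommutativeMonoid)
open import Data.Nat using (ℕ; suc; _<_; _≤_; _/_; NonZero)
open import Data.Nat.Divisibility using (_∣_)
open import Data.Fin using (Fin; zero)
open import Data.Product using (_×_)
open import Function.Bundles using (_⇔_)
open import Relation.Nullary using (¬_)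

import Algebra.Properties.AbelianGroup
import Algebra.Properties.CommutativeSemigroup
import Algebra.Properties.Ring
import Algebra.Properties.Semiring.Exp
import Algebra.Solver.Ring
open import Algebra.Solver.Ring.AlmostCommutativeRing using (fromCommutativeRing; _-Raw-AlmostCommutative⟶_)
open import Data.Empty using (⊥-elim)
open import Data.Fin as Fin using (toℕ)
open import Data.Integer as ℤ using (+_; -[1+_]; _⊖_)
import Data.Integer.Properties as ℤ
open import Data.List as List using (List; []; _∷_; foldr; map; filter; upTo; applyUpTo; allFin; reverse; length; tabulate)
import Data.List.Properties as List
open import Data.List.Membership.Propositional using (_∈_; find)
open import Data.List.Membership.Propositional.Properties using (∈-filter⁺; ∈-filter⁻; ∈-map⁺; ∈-map⁻; ∈-upTo⁺; ∈-upTo⁻)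
open import Data.List.Relation.Unary.All as All using (All; []; _∷_)
open import Data.List.Relation.Unary.AllPairs using (AllPairs; []; _∷_)
import Data.List.Relation.Unary.AllPairs.Properties as AllPairs
open import Data.List.Relation.Unary.Any as Any using (Any; here; there; any?)
open import Data.Maybe using (Maybe; just; nothing)
open import Data.Nat as ℕ using (zero; z≤n; s≤s)
open import Data.Nat.Coprimality using (Coprime; coprime-divisor; coprime⇒gcd≡1; gcd≡1⇒coprime)
import Data.Nat.Coprimality as Coprime
open import Data.Nat.Divisibility
open import Data.Nat.DivMod using (_%_; m≡m%n+[m/n]*n; m%n<n; m*[n/m]≡n; m/n*n≡m)
open import Data.Nat.GCD using (gcd; gcd[m,n]∣m; gcd[m,n]∣n; gcd[m,n]≢0)
open import Data.Nat.Induction using (<-rec)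
open import Data.Nat.ListAction using (sum; product)
open import Data.Nat.Primality
open import Data.Nat.Primality.Factorisation using (factorise)
import Data.Nat.Properties as ℕ
open import Data.Product using (Σ; ∃-syntax; _,_; proj₁; proj₂)
open import Data.Sum using (_⊎_; inj₁; inj₂)
open import Function using (_∘_; flip; mk⇔; Equivalence)
open import Function.Properties.Equivalence using () renaming (trans to ⇔-trans; sym to ⇔-sym)
open import Induction.WellFounded using (WfRec)
open import Relation.Binary.Definitions using (tri<; tri≈; tri>)
open import Relation.Binary.PropositionalEquality as ≡ using (_≡_; _≢_)
import Relation.Binary.Reasoning.Setoid
open import Relation.Nullary using (Dec; yes; no)
open import Relation.Nullary.Decidable using (_×-dec_)
open import Relation.Unary using (Pred)

module RangeFold {a ℓ} (M : CommutativeMonoid a ℓ) where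
  open CommutativeMonoid M
  open Algebra.Properties.CommutativeSemigroup commutativeSemigroup using (interchange; x∙yz≈y∙xz)
  open Relation.Binary.Reasoning.Setoid setoid

  fold : ℕ → (ℕ → Carrier) → Carrier
  fold zero    f = ε
  fold (suc n) f = f 0 ∙ fold n (f ∘ suc)

  when : ∀ {p} {P : Set p} → Dec P → Carrier → Carrier
  when (yes _) x = x
  when (no _)  _ = ε

  when-yes : ∀ {p} {P : Set p} (P? : Dec P) → P → ∀ x → when P? x ≈ x
  when-yes (yes _) _ x = refl
  when-yes (no ¬p) p x = ⊥-elim (¬p p)

  when-no : ∀ {p} {P : Set p} (P? : Dec P) → ¬ P → ∀ x → when P? x ≈ ε
  when-no (yes p) ¬p x = ⊥-elim (¬p p)
  when-no (no _)  _  x = refl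

  when-cong : ∀ {p q} {P : Set p} {Q : Set q} (P? : Dec P) (Q? : Dec Q) → (P → Q) → (Q → P) →
              ∀ {x y} → (Q → x ≈ y) → when P? x ≈ when Q? y
  when-cong (yes _) (yes q) _   _   x≈y = x≈y q
  when-cong (yes p) (no ¬q) P→Q _   _   = ⊥-elim (¬q (P→Q p))
  when-cong (no ¬p) (yes q) _   Q→P _   = ⊥-elim (¬p (Q→P q))
  when-cong (no _)  (no _)  _   _   _   = refl

  when-homo : ∀ {p} {P : Set p} (h : Carrier → Carrier) → h ε ≈ ε → (P? : Dec P) → ∀ x → h (when P? x) ≈ when P? (h x)
  when-homo h h-ε (yes _) x = refl
  when-homo h h-ε (no _)  x = h-ε

  fold-cong : ∀ n {f g} → (∀ i → i < n → f i ≈ g i) → fold n f ≈ fold n g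
  fold-cong zero    f≈g = refl
  fold-cong (suc n) f≈g = ∙-cong (f≈g 0 (s≤s z≤n)) (fold-cong n (λ i i<n → f≈g (suc i) (s≤s i<n)))

  fold-ε : ∀ n {f} → (∀ i → i < n → f i ≈ ε) → fold n f ≈ ε
  fold-ε zero    f≈ε = refl
  fold-ε (suc n) f≈ε = trans (∙-cong (f≈ε 0 (s≤s z≤n)) (fold-ε n (λ i i<n → f≈ε (suc i) (s≤s i<n)))) (identityˡ ε)

  fold-∙ : ∀ n f g → fold n (λ i → f i ∙ g i) ≈ fold n f ∙ fold n g
  fold-∙ zero    f g = sym (identityˡ ε)
  fold-∙ (suc n) f g = trans (∙-congˡ (fold-∙ n (f ∘ suc) (g ∘ suc))) (interchange _ _ _ _)

  fold-split : ∀ m n f → fold (m ℕ.+ n) f ≈ fold m f ∙ fold n (λ i → f (m ℕ.+ i))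
  fold-split zero    n f = sym (identityˡ _)
  fold-split (suc m) n f = trans (∙-congˡ (fold-split m n (f ∘ suc))) (sym (assoc _ _ _))

  fold-truncate : ∀ m n f → m ≤ n → (∀ i → m ≤ i → i < n → f i ≈ ε) → fold n f ≈ fold m f
  fold-truncate m n f m≤n f≈ε = begin
    fold n f                                     ≡⟨ ≡.cong (λ k → fold k f) (≡.sym (ℕ.m+[n∸m]≡n m≤n)) ⟩
    fold (m ℕ.+ (n ℕ.∸ m)) f                     ≈⟨ fold-split m (n ℕ.∸ m) f ⟩
    fold m f ∙ fold (n ℕ.∸ m) (λ i → f (m ℕ.+ i)) ≈⟨ ∙-congˡ (fold-ε (n ℕ.∸ m) tail≈ε) ⟩
    fold m f ∙ ε                                 ≈⟨ identityʳ _ ⟩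
    fold m f                                     ∎
    where
    tail≈ε : ∀ i → i < n ℕ.∸ m → f (m ℕ.+ i) ≈ ε
    tail≈ε i i<n∸m =
      f≈ε (m ℕ.+ i) (ℕ.m≤m+n m i) (ℕ.<-≤-trans (ℕ.+-monoʳ-< m i<n∸m) (ℕ.≤-reflexive (ℕ.m+[n∸m]≡n m≤n)))

  fold-single : ∀ n t f → t < n → (∀ i → i < n → i ≢ t → f i ≈ ε) → fold n f ≈ f t
  fold-single (suc n) zero    f _         rest≈ε =
    trans (∙-congˡ (fold-ε n (λ i i<n → rest≈ε (suc i) (s≤s i<n) (λ ())))) (identityʳ _)
  fold-single (suc n) (suc t) f (s≤s t<n) rest≈ε =
    trans (∙-cong (rest≈ε 0 (s≤s z≤n) (λ ())) (fold-single n t (f ∘ suc) t<n rest≈ε′)) (identityˡ _)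
    where
    rest≈ε′ : ∀ i → i < n → i ≢ t → f (suc i) ≈ ε
    rest≈ε′ i i<n i≢t = rest≈ε (suc i) (s≤s i<n) (i≢t ∘ ℕ.suc-injective)

  fold-update : ∀ n t f g c → t < n → (∀ i → i < n → i ≢ t → f i ≈ g i) → f t ≈ c ∙ g t → fold n f ≈ c ∙ fold n g
  fold-update (suc n) zero    f g c _         f≈g f[t]≈ =
    trans (∙-cong f[t]≈ (fold-cong n (λ i i<n → f≈g (suc i) (s≤s i<n) (λ ())))) (assoc _ _ _)
  fold-update (suc n) (suc t) f g c (s≤s t<n) f≈g f[t]≈ = begin
    f 0 ∙ fold n (f ∘ suc)
      ≈⟨ ∙-cong (f≈g 0 (s≤s z≤n) (λ ())) (fold-update n t (f ∘ suc) (g ∘ suc) c t<n f≈g′ f[t]≈) ⟩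
    g 0 ∙ (c ∙ fold n (g ∘ suc))
      ≈⟨ x∙yz≈y∙xz _ _ _ ⟩
    c ∙ (g 0 ∙ fold n (g ∘ suc))  ∎
    where
    f≈g′ : ∀ i → i < n → i ≢ t → f (suc i) ≈ g (suc i)
    f≈g′ i i<n i≢t = f≈g (suc i) (s≤s i<n) (i≢t ∘ ℕ.suc-injective)

  fold-comm : ∀ m n (u : ℕ → ℕ → Carrier) → fold m (λ i → fold n (u i)) ≈ fold n (λ j → fold m (λ i → u i j))
  fold-comm zero    n u = sym (fold-ε n (λ _ _ → refl))
  fold-comm (suc m) n u = trans (∙-congˡ (fold-comm m n (u ∘ suc))) (sym (fold-∙ n (u 0) _))

  fold-homo : ∀ (h : Carrier → Carrier) → h ε ≈ ε → (∀ x y → h (x ∙ y) ≈ h x ∙ h y) →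
              ∀ n f → h (fold n f) ≈ fold n (h ∘ f)
  fold-homo h h-ε h-∙ zero    f = h-ε
  fold-homo h h-ε h-∙ (suc n) f = trans (h-∙ _ _) (∙-congˡ (fold-homo h h-ε h-∙ n (f ∘ suc)))

  -- Index i stands for the number i + 1, so only the multiples of p among 1, …, p k survive on the left.
  fold-multiples : ∀ p k .{{_ : ℕ.NonZero p}} (f : ℕ → Carrier) →
                   fold (p ℕ.* k) (λ i → when (p ∣? suc i) (f (suc i))) ≈ fold k (λ j → f (p ℕ.* suc j))
  fold-multiples p zero    f = reflexive (≡.cong (λ n → fold n (λ i → when (p ∣? suc i) (f (suc i)))) (ℕ.*-zeroʳ p))
  fold-multiples p (suc k) f = begin
    fold (p ℕ.* suc k) g
      ≡⟨ ≡.cong (λ n → fold n g) (ℕ.*-suc p k) ⟩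
    fold (p ℕ.+ p ℕ.* k) g
      ≈⟨ fold-split p (p ℕ.* k) g ⟩
    fold p g ∙ fold (p ℕ.* k) (λ i → g (p ℕ.+ i))
      ≈⟨ ∙-cong first-block (fold-cong (p ℕ.* k) (λ i _ → shifted i)) ⟩
    f (p ℕ.* 1) ∙ fold (p ℕ.* k) (λ i → when (p ∣? suc i) (f (p ℕ.+ suc i)))
      ≈⟨ ∙-congˡ (fold-multiples p k (λ x → f (p ℕ.+ x))) ⟩
    f (p ℕ.* 1) ∙ fold k (λ j → f (p ℕ.+ p ℕ.* suc j))
      ≈⟨ ∙-congˡ (fold-cong k (λ j _ → reflexive (≡.cong f (≡.sym (ℕ.*-suc p (suc j)))))) ⟩
    f (p ℕ.* 1) ∙ fold k (λ j → f (p ℕ.* suc (suc j))) ∎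
    where
    g : ℕ → Carrier
    g i = when (p ∣? suc i) (f (suc i))
    first-block : fold p g ≈ f (p ℕ.* 1)
    first-block = begin
      fold p g           ≈⟨ fold-single p (ℕ.pred p) g (ℕ.≤-reflexive (ℕ.suc-pred p)) only-last ⟩
      g (ℕ.pred p)       ≈⟨ when-yes (p ∣? suc (ℕ.pred p)) (≡.subst (p ∣_) (≡.sym (ℕ.suc-pred p)) ∣-refl) _ ⟩
      f (suc (ℕ.pred p)) ≡⟨ ≡.cong f (≡.trans (ℕ.suc-pred p) (≡.sym (ℕ.*-identityʳ p))) ⟩
      f (p ℕ.* 1)        ∎
      where
      only-last : ∀ i → i < p → i ≢ ℕ.pred p → g i ≈ ε
      only-last i i<p i≢ = when-no (p ∣? suc i) (λ p∣1+i → i≢ (ℕ.suc-injective (≡.trans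
        (ℕ.≤-antisym i<p (∣⇒≤ p∣1+i)) (≡.sym (ℕ.suc-pred p))))) _
    shifted : ∀ i → g (p ℕ.+ i) ≈ when (p ∣? suc i) (f (p ℕ.+ suc i))
    shifted i = when-cong (p ∣? suc (p ℕ.+ i)) (p ∣? suc i)
      (λ p∣ → ∣m+n∣m⇒∣n (≡.subst (p ∣_) (≡.sym (ℕ.+-suc p i)) p∣) ∣-refl)
      (λ p∣ → ≡.subst (p ∣_) (ℕ.+-suc p i) (∣m∣n⇒∣m+n ∣-refl p∣))
      (λ _ → reflexive (≡.cong f (≡.sym (ℕ.+-suc p i))))

  foldr-map-cong : ∀ {b} {A : Set b} (xs : List A) {f g : A → Carrier} →
                   (∀ x → x ∈ xs → f x ≈ g x) → foldr _∙_ ε (map f xs) ≈ foldr _∙_ ε (map g xs)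
  foldr-map-cong []       f≈g = refl
  foldr-map-cong (x ∷ xs) f≈g = ∙-cong (f≈g x (here ≡.refl)) (foldr-map-cong xs (λ y y∈xs → f≈g y (there y∈xs)))

  foldr-filter : ∀ {b p} {A : Set b} {P : Pred A p} (P? : ∀ x → Dec (P x)) (xs : List A) (f : A → Carrier) →
                 foldr _∙_ ε (map f (filter P? xs)) ≈ foldr _∙_ ε (map (λ x → when (P? x) (f x)) xs)
  foldr-filter P? []       f = refl
  foldr-filter P? (x ∷ xs) f with P? x
  ... | yes _ = ∙-congˡ (foldr-filter P? xs f)
  ... | no  _ = trans (foldr-filter P? xs f) (sym (identityˡ _))

  foldr-applyUpTo : ∀ n (g : ℕ → ℕ) (f : ℕ → Carrier) → foldr _∙_ ε (map f (applyUpTo g n)) ≡ fold n (f ∘ g)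
  foldr-applyUpTo zero    g f = ≡.refl
  foldr-applyUpTo (suc n) g f = ≡.cong (f (g 0) ∙_) (foldr-applyUpTo n (g ∘ suc) f)

  fold-foldr-comm : ∀ {b} {A : Set b} n (ys : List A) (u : ℕ → A → Carrier) →
                    fold n (λ i → foldr _∙_ ε (map (u i) ys)) ≈ foldr _∙_ ε (map (λ y → fold n (λ i → u i y)) ys)
  fold-foldr-comm n []       u = fold-ε n (λ _ _ → refl)
  fold-foldr-comm n (y ∷ ys) u = trans (fold-∙ n (λ i → u i y) _) (∙-congˡ (fold-foldr-comm n ys u))

  foldr-homo : ∀ {b} {A : Set b} (h : Carrier → Carrier) → h ε ≈ ε → (∀ x y → h (x ∙ y) ≈ h x ∙ h y) →
               ∀ (xs : List A) f → h (foldr _∙_ ε (map f xs)) ≈ foldr _∙_ ε (map (h ∘ f) xs)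
  foldr-homo h h-ε h-∙ []       f = h-ε
  foldr-homo h h-ε h-∙ (x ∷ xs) f = trans (h-∙ _ _) (∙-congˡ (foldr-homo h h-ε h-∙ xs f))

module Arithmetic where
  open import Data.Nat using (_*_)
  open import Relation.Binary.PropositionalEquality using (refl)

  1<prime : ∀ {p} → Prime p → 1 < p
  1<prime {p} (prime {{p>1}} _) = ℕ.nonTrivial⇒n>1 p {{p>1}}

  suc-pred-prime : ∀ {p} → Prime p → suc (ℕ.pred p) ≡ p
  suc-pred-prime p-prime = ℕ.suc-pred _ {{prime⇒nonZero p-prime}}

  prime-factor : ∀ n → 1 < n → ∃[ p ] Prime p × p ∣ n
  prime-factor n 1<n with factorise n {{ℕ.>-nonZero (ℕ.<-trans (ℕ.s≤s ℕ.z≤n) 1<n)}}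
  ... | record { factors = [] ; isFactorisation = n≡1 } = ⊥-elim (ℕ.<⇒≢ 1<n (≡.sym n≡1))
  ... | record { factors = p ∷ ps ; isFactorisation = n≡p*ps ; factorsPrime = p-prime ∷ _ } =
    p , p-prime , divides (product ps) (≡.trans n≡p*ps (ℕ.*-comm p (product ps)))

  prime∣prime⇒≡ : ∀ {q p} → Prime q → Prime p → q ∣ p → q ≡ p
  prime∣prime⇒≡ q-prime p-prime q∣p with prime⇒irreducible p-prime q∣p
  ... | inj₁ q≡1 = ⊥-elim (ℕ.<⇒≢ (1<prime q-prime) (≡.sym q≡1))
  ... | inj₂ q≡p = q≡p

  prime∤⇒coprime : ∀ {p d} → Prime p → ¬ p ∣ d → Coprime p d
  prime∤⇒coprime p-prime p∤d (i∣p , i∣d) with prime⇒irreducible p-prime i∣p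
  ... | inj₁ i≡1 = i≡1
  ... | inj₂ refl = ⊥-elim (p∤d i∣d)

  prime∤∧∣p*⇒∣ : ∀ {p d x} → Prime p → ¬ p ∣ d → d ∣ p * x → d ∣ x
  prime∤∧∣p*⇒∣ p-prime p∤d = coprime-divisor (Coprime.sym (prime∤⇒coprime p-prime p∤d))

  p²∣new-divisor : ∀ {p M d} → Prime p → p ∣ M → d ∣ p * M → ¬ d ∣ M → p * p ∣ d
  p²∣new-divisor {p} {M} {d} p-prime p∣M d∣pM d∤M with p ∣? d
  ... | no  p∤d = ⊥-elim (d∤M (prime∤∧∣p*⇒∣ p-prime p∤d d∣pM))
  ... | yes (divides e refl) with p ∣? e
  ...   | yes (divides f refl) = divides f (ℕ.*-assoc f p p)
  ...   | no  p∤e = ⊥-elim (d∤M (≡.subst (e * p ∣_) (m/n*n≡m p∣M) (*-monoˡ-∣ p e∣M/p)))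
    where
    instance
      p≢0 : NonZero p
      p≢0 = prime⇒nonZero p-prime
    e∣M/p : e ∣ M / p
    e∣M/p = prime∤∧∣p*⇒∣ p-prime p∤e (≡.subst (e ∣_) (≡.sym (m*[n/m]≡n p∣M))
              (*-cancelˡ-∣ p (≡.subst (_∣ p * M) (ℕ.*-comm e p) d∣pM)))

  PrimeDivisor : ℕ → ℕ → Set
  PrimeDivisor d p = Prime p × p ∣ d

  primeDivisor? : ∀ d p → Dec (PrimeDivisor d p)
  primeDivisor? d p = prime? p ×-dec (p ∣? d)

  ∈-primeDivsPred⁺ : ∀ {d p} .{{_ : NonZero d}} → PrimeDivisor d p → ℕ.pred p ∈ primeDivsPred d
  ∈-primeDivsPred⁺ {d} {p} (p-prime , p∣d) =
    ∈-filter⁺ (λ k → primeDivisor? d (suc k)) (∈-upTo⁺ (≡.subst (_≤ d) p≡1+k (∣⇒≤ p∣d)))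
      (≡.subst (PrimeDivisor d) p≡1+k (p-prime , p∣d))
    where
    p≡1+k : p ≡ suc (ℕ.pred p)
    p≡1+k = ≡.sym (suc-pred-prime p-prime)

  ∈-primeDivsPred⁻ : ∀ {d k} → k ∈ primeDivsPred d → PrimeDivisor d (suc k)
  ∈-primeDivsPred⁻ {d} = proj₂ ∘ ∈-filter⁻ (λ k → primeDivisor? d (suc k)) {xs = upTo d}

  Squareful : ℕ → Set
  Squareful d = Any (λ q → q * q ∣ d) (primeDivs d)

  squareful? : ∀ d → Dec (Squareful d)
  squareful? d = any? (λ q → (q * q) ∣? d) (primeDivs d)

  squareful⁺ : ∀ {q d} .{{_ : NonZero d}} → Prime q → q * q ∣ d → Squareful d
  squareful⁺ {q} {d} q-prime q²∣d = Any.map (λ { refl → q²∣d }) (Any.map ≡.sym q∈primeDivs)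
    where
    q∈primeDivs : q ∈ primeDivs d
    q∈primeDivs = ≡.subst (_∈ primeDivs d) (suc-pred-prime q-prime)
      (∈-map⁺ suc (∈-primeDivsPred⁺ (q-prime , m*n∣⇒m∣ q q q²∣d)))

  squareful⁻ : ∀ {d} → Squareful d → ∃[ q ] Prime q × q * q ∣ d
  squareful⁻ {d} sq with find sq
  ... | q , q∈ , q²∣d with ∈-map⁻ suc q∈
  ...   | k , k∈ , refl = q , proj₁ (∈-primeDivsPred⁻ {d} k∈) , q²∣d

  μ-squareful : ∀ {d} → Squareful d → μ d ≡ ℤ.+ 0
  μ-squareful {d} sq with squareful? d
  ... | yes _  = refl
  ... | no ¬sq = ⊥-elim (¬sq sq)

  μ-squarefree : ∀ {d} → ¬ Squareful d → μ d ≡ (ℤ.- ℤ.1ℤ) ℤ.^ List.length (primeDivs d)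
  μ-squarefree {d} ¬sq with squareful? d
  ... | yes sq = ⊥-elim (¬sq sq)
  ... | no _   = refl

  module _ {p e} (p-prime : Prime p) .{{_ : NonZero e}} where
    private instance
      p≢0 : NonZero p
      p≢0 = prime⇒nonZero p-prime
      pe≢0 : NonZero (p ℕ.* e)
      pe≢0 = ℕ.m*n≢0 p e

    squareful-* : Squareful e → Squareful (p * e)
    squareful-* sq with squareful⁻ sq
    ... | q , q-prime , q²∣e = squareful⁺ q-prime (∣n⇒∣m*n p q²∣e)

    squareful-*⁻ : ¬ p ∣ e → Squareful (p * e) → Squareful e
    squareful-*⁻ p∤e sq with squareful⁻ sq
    ... | q , q-prime , q²∣pe with q ℕ.≟ p
    ...   | yes refl = ⊥-elim (p∤e (*-cancelˡ-∣ p (∣-trans (∣-refl {p * p}) q²∣pe)))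
    ...   | no  q≢p  = squareful⁺ q-prime (prime∤∧∣p*⇒∣ p-prime p∤q² q²∣pe)
      where
      p∤q² : ¬ p ∣ q * q
      p∤q² p∣q² with euclidsLemma q q p-prime p∣q²
      ... | inj₁ p∣q = q≢p (≡.sym (prime∣prime⇒≡ p-prime q-prime p∣q))
      ... | inj₂ p∣q = q≢p (≡.sym (prime∣prime⇒≡ p-prime q-prime p∣q))

  primeDivisor-*⁺ : ∀ {p e q} → PrimeDivisor e q → PrimeDivisor (p * e) q
  primeDivisor-*⁺ {p} (q-prime , q∣e) = q-prime , ∣n⇒∣m*n p q∣e

  primeDivisor-*⁻ : ∀ {p e q} → Prime p → PrimeDivisor (p * e) q → q ≡ p ⊎ PrimeDivisor e q
  primeDivisor-*⁻ {p} {e} p-prime (q-prime , q∣pe) with euclidsLemma p e q-prime q∣pe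
  ... | inj₁ q∣p = inj₁ (prime∣prime⇒≡ q-prime p-prime q∣p)
  ... | inj₂ q∣e = inj₂ (q-prime , q∣e)

  ∣⇒nonZero : ∀ {m n} .{{_ : NonZero n}} → m ∣ n → NonZero m
  ∣⇒nonZero {zero}  {n} 0∣n = ⊥-elim (ℕ.≢-nonZero⁻¹ n (0∣⇒≡0 0∣n))
  ∣⇒nonZero {suc m}     _   = _

  common-prime-divisor : ∀ t N .{{_ : NonZero N}} → gcd t N ≢ 1 → ∃[ p ] Prime p × p ∣ t × p ∣ N
  common-prime-divisor t N g≢1
    with prime-factor (gcd t N) (ℕ.≤∧≢⇒< (ℕ.n≢0⇒n>0 (gcd[m,n]≢0 t N (inj₂ (ℕ.≢-nonZero⁻¹ N)))) (g≢1 ∘ ≡.sym))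
  ... | p , p-prime , p∣g = p , p-prime , ∣-trans p∣g (gcd[m,n]∣m t N) , ∣-trans p∣g (gcd[m,n]∣n t N)

  coprime-∸ : ∀ {k N} → k ≤ N → gcd k N ≡ 1 → gcd (N ℕ.∸ k) N ≡ 1
  coprime-∸ {k} {N} k≤N gcd≡1 = coprime⇒gcd≡1 λ {i} (i∣N-k , i∣N) →
    gcd≡1⇒coprime {k} {N} gcd≡1
      (∣m+n∣m⇒∣n {m = N ℕ.∸ k} {n = k} (≡.subst (i ∣_) (≡.sym (ℕ.m∸n+n≡m k≤N)) i∣N) i∣N-k , i∣N)

  m∣n∧m∣o⇒n∣o*[n/m] : ∀ {k n o} → suc k ∣ n → suc k ∣ o → n ∣ o * (n / suc k)
  m∣n∧m∣o⇒n∣o*[n/m] {k} {n} {o} m∣n (divides r ≡.refl) =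
    divides r (≡.trans (ℕ.*-assoc r (suc k) (n / suc k)) (≡.cong (r *_) (m*[n/m]≡n m∣n)))

  m∣n∧n∣o*[n/m]⇒m∣o : ∀ {k n o} .{{_ : NonZero n}} → suc k ∣ n → n ∣ o * (n / suc k) → suc k ∣ o
  m∣n∧n∣o*[n/m]⇒m∣o {k} {n} {o} m∣n n∣o*q = *-cancelˡ-∣ (n / suc k) {{q≢0}}
    (≡.subst₂ _∣_ (≡.sym (m/n*n≡m m∣n)) (ℕ.*-comm o (n / suc k)) n∣o*q)
    where
    q≢0 : NonZero (n / suc k)
    q≢0 = ℕ.≢-nonZero λ q≡0 → ℕ.≢-nonZero⁻¹ n (≡.trans (≡.sym (m/n*n≡m m∣n)) (≡.cong (_* suc k) q≡0))

  coprimes : ℕ → List ℕ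
  coprimes N = filter (λ j → gcd j N ℕ.≟ 1) (map suc (upTo N))

  ∈-coprimes⁺ : ∀ {k N} → 0 < k → k ≤ N → gcd k N ≡ 1 → k ∈ coprimes N
  ∈-coprimes⁺ {suc i} {N} _ 1+i≤N gcd≡1 = ∈-filter⁺ (λ j → gcd j N ℕ.≟ 1) (∈-map⁺ suc (∈-upTo⁺ 1+i≤N)) gcd≡1

  ∈-coprimes⁻ : ∀ {k N} → k ∈ coprimes N → 0 < k × k ≤ N × gcd k N ≡ 1
  ∈-coprimes⁻ {k} {N} k∈ with ∈-filter⁻ (λ j → gcd j N ℕ.≟ 1) {xs = map suc (upTo N)} k∈
  ... | k∈′ , gcd≡1 with ∈-map⁻ suc k∈′
  ...   | i , i∈ , refl = ℕ.s≤s ℕ.z≤n , ∈-upTo⁻ i∈ , gcd≡1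

  ∸-split : ∀ {n h H} → h ℕ.+ H ≤ n → n ℕ.∸ h ≡ n ℕ.∸ (h ℕ.+ H) ℕ.+ H
  ∸-split {n} {h} {H} h+H≤n = ≡.sym (≡.trans (≡.cong (ℕ._+ H) (≡.sym (ℕ.∸-+-assoc n h H)))
    (ℕ.m∸n+n≡m (ℕ.m+n≤o⇒m≤o∸n H (≡.subst (_≤ n) (ℕ.+-comm h H) h+H≤n))))

  [n/2]+[n/2]≡n : ∀ {n} → 2 ∣ n → n / 2 ℕ.+ n / 2 ≡ n
  [n/2]+[n/2]≡n {n} 2∣n =
    ≡.trans (≡.cong (n / 2 ℕ.+_) (≡.sym (ℕ.+-identityʳ (n / 2)))) (≡.trans (ℕ.*-comm 2 (n / 2)) (m/n*n≡m 2∣n))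

  0<n/2<n : ∀ {n} .{{_ : NonZero n}} → 2 ∣ n → 0 < n / 2 × n / 2 < n
  0<n/2<n {n} 2∣n with n / 2 | [n/2]+[n/2]≡n 2∣n
  ... | zero  | 0≡n = ⊥-elim (ℕ.≢-nonZero⁻¹ n (≡.sym 0≡n))
  ... | suc h | h+h≡n = ℕ.s≤s ℕ.z≤n , ≡.subst (suc h <_) h+h≡n (ℕ.m<m+n (suc h) (ℕ.s≤s ℕ.z≤n))

open Arithmetic

module RingFacts {c ℓ} (K : CommutativeRing c ℓ) where
  open CommutativeRing K
  open Algebra.Properties.Ring ring public
  open Algebra.Properties.AbelianGroup +-abelianGroup public using (⁻¹-∙-comm)
  open Algebra.Properties.CommutativeSemigroup +-commutativeSemigroup public using (interchange)
  open Algebra.Properties.CommutativeSemigroup *-commutativeSemigroup public using () renaming (x∙yz≈y∙xz to x*yz≈y*xz)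
  open Algebra.Properties.Semiring.Exp semiring public using (_^_; ^-homo-*; ^-assocʳ; ^-congˡ)
  open Relation.Binary.Reasoning.Setoid setoid public

  module ∑ = RangeFold +-commutativeMonoid
  module ∏ = RangeFold *-commutativeMonoid

  x-y≈0⇒x≈y : ∀ {x y} → x - y ≈ 0# → x ≈ y
  x-y≈0⇒x≈y = x∙y⁻¹≈ε⇒x≈y _ _

  field-cancel : IsCharZeroField K → ∀ {x y} → ¬ x ≈ 0# → x * y ≈ 0# → y ≈ 0#
  field-cancel F {x} {y} x≉0 xy≈0 with IsCharZeroField.inverse F x x≉0
  ... | x⁻¹ , xx⁻¹≈1 = begin
    y              ≈⟨ *-identityˡ y ⟨
    1# * y         ≈⟨ *-congʳ (trans (*-comm _ _) xx⁻¹≈1) ⟨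
    (x⁻¹ * x) * y  ≈⟨ *-assoc _ _ _ ⟩
    x⁻¹ * (x * y)  ≈⟨ *-congˡ xy≈0 ⟩
    x⁻¹ * 0#       ≈⟨ zeroʳ _ ⟩
    0#             ∎

  pow≡^ : ∀ x n → pow K x n ≡ x ^ n
  pow≡^ x zero    = ≡.refl
  pow≡^ x (suc n) = ≡.cong (x *_) (pow≡^ x n)

  ^-sum : ∀ x (e : ℕ → ℕ) ks → x ^ sum (map e ks) ≈ foldr _*_ 1# (map (λ k → x ^ e k) ks)
  ^-sum x e []       = refl
  ^-sum x e (k ∷ ks) = trans (^-homo-* x (e k) _) (*-congˡ (^-sum x e ks))

  ∏-≈0 : ∀ {b} {A : Set b} (xs : List A) h {x} → x ∈ xs → h x ≈ 0# → foldr _*_ 1# (map h xs) ≈ 0#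
  ∏-≈0 (x ∷ xs) h (here ≡.refl) hx≈0 = trans (*-congʳ hx≈0) (zeroˡ _)
  ∏-≈0 (y ∷ xs) h (there x∈xs)  hx≈0 = trans (*-congˡ (∏-≈0 xs h x∈xs hx≈0)) (zeroʳ _)

  ofℕ-+ : ∀ m n → ofℕ K (m ℕ.+ n) ≈ ofℕ K m + ofℕ K n
  ofℕ-+ zero    n = sym (+-identityˡ _)
  ofℕ-+ (suc m) n = trans (+-congˡ (ofℕ-+ m n)) (sym (+-assoc _ _ _))

  ofℕ-* : ∀ m n → ofℕ K (m ℕ.* n) ≈ ofℕ K m * ofℕ K n
  ofℕ-* zero    n = sym (zeroˡ _)
  ofℕ-* (suc m) n = begin
    ofℕ K (n ℕ.+ m ℕ.* n)            ≈⟨ ofℕ-+ n (m ℕ.* n) ⟩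
    ofℕ K n + ofℕ K (m ℕ.* n)        ≈⟨ +-cong (sym (*-identityˡ _)) (ofℕ-* m n) ⟩
    1# * ofℕ K n + ofℕ K m * ofℕ K n ≈⟨ sym (distribʳ _ _ _) ⟩
    (1# + ofℕ K m) * ofℕ K n         ∎

  ofℤ-neg : ∀ i → ofℤ K (ℤ.- i) ≈ - ofℤ K i
  ofℤ-neg (+ zero)  = sym -0#≈0#
  ofℤ-neg (+ suc n) = refl
  ofℤ-neg -[1+ n ]  = sym (-‿involutive _)

  ofℤ-⊖ : ∀ m n → ofℤ K (m ⊖ n) ≈ ofℕ K m - ofℕ K n
  ofℤ-⊖ m       zero    = sym (trans (+-congˡ -0#≈0#) (+-identityʳ _))
  ofℤ-⊖ zero    (suc n) = sym (+-identityˡ _)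
  ofℤ-⊖ (suc m) (suc n) = begin
    ofℤ K (suc m ⊖ suc n)                        ≡⟨ ≡.cong (ofℤ K) (ℤ.[1+m]⊖[1+n]≡m⊖n m n) ⟩
    ofℤ K (m ⊖ n)                                ≈⟨ ofℤ-⊖ m n ⟩
    ofℕ K m - ofℕ K n                            ≈⟨ sym (+-identityˡ _) ⟩
    0# + (ofℕ K m - ofℕ K n)                     ≈⟨ +-congʳ (sym (-‿inverseʳ 1#)) ⟩
    (1# - 1#) + (ofℕ K m - ofℕ K n)              ≈⟨ interchange _ _ _ _ ⟩
    (1# + ofℕ K m) + (- 1# - ofℕ K n)            ≈⟨ +-congˡ (⁻¹-∙-comm 1# (ofℕ K n)) ⟩
    (1# + ofℕ K m) - (1# + ofℕ K n)              ∎

  ofℤ-+ : ∀ i j → ofℤ K (i ℤ.+ j) ≈ ofℤ K i + ofℤ K j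
  ofℤ-+ (+ m)    (+ n)    = ofℕ-+ m n
  ofℤ-+ (+ m)    -[1+ n ] = ofℤ-⊖ m (suc n)
  ofℤ-+ -[1+ m ] (+ n)    = trans (ofℤ-⊖ n (suc m)) (+-comm _ _)
  ofℤ-+ -[1+ m ] -[1+ n ] = begin
    ofℤ K (-[1+ m ] ℤ.+ -[1+ n ])         ≡⟨ ≡.cong (ofℤ K) (≡.sym (ℤ.neg-distrib-+ (+ suc m) (+ suc n))) ⟩
    ofℤ K (ℤ.- (+ suc m ℤ.+ + suc n))     ≈⟨ ofℤ-neg (+ suc m ℤ.+ + suc n) ⟩
    - ofℕ K (suc m ℕ.+ suc n)            ≈⟨ -‿cong (ofℕ-+ (suc m) (suc n)) ⟩
    - (ofℕ K (suc m) + ofℕ K (suc n))    ≈⟨ sym (⁻¹-∙-comm _ _) ⟩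
    - ofℕ K (suc m) - ofℕ K (suc n)      ∎

  ofℤ-*-+ : ∀ i n → ofℤ K (i ℤ.* + n) ≈ ofℤ K i * ofℕ K n
  ofℤ-*-+ (+ m)    n = trans (reflexive (≡.cong (ofℤ K) (≡.sym (ℤ.pos-* m n)))) (ofℕ-* m n)
  ofℤ-*-+ -[1+ m ] n = begin
    ofℤ K (ℤ.- (+ suc m) ℤ.* + n)    ≡⟨ ≡.cong (ofℤ K) (≡.sym (ℤ.neg-distribˡ-* (+ suc m) (+ n))) ⟩
    ofℤ K (ℤ.- (+ suc m ℤ.* + n))    ≈⟨ ofℤ-neg (+ suc m ℤ.* + n) ⟩
    - ofℤ K (+ suc m ℤ.* + n)        ≈⟨ -‿cong (ofℤ-*-+ (+ suc m) n) ⟩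
    - (ofℕ K (suc m) * ofℕ K n)      ≈⟨ -‿distribˡ-* _ _ ⟩
    - ofℕ K (suc m) * ofℕ K n        ∎

  ofℤ-* : ∀ i j → ofℤ K (i ℤ.* j) ≈ ofℤ K i * ofℤ K j
  ofℤ-* i (+ n)    = ofℤ-*-+ i n
  ofℤ-* i -[1+ n ] = begin
    ofℤ K (i ℤ.* ℤ.- (+ suc n))      ≡⟨ ≡.cong (ofℤ K) (≡.sym (ℤ.neg-distribʳ-* i (+ suc n))) ⟩
    ofℤ K (ℤ.- (i ℤ.* + suc n))      ≈⟨ ofℤ-neg (i ℤ.* + suc n) ⟩
    - ofℤ K (i ℤ.* + suc n)          ≈⟨ -‿cong (ofℤ-*-+ i (suc n)) ⟩
    - (ofℤ K i * ofℕ K (suc n))      ≈⟨ -‿distribʳ-* _ _ ⟩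
    ofℤ K i * - ofℕ K (suc n)        ∎

  ofℤ-morphism : ℤ.+-*-rawRing -Raw-AlmostCommutative⟶ fromCommutativeRing K
  ofℤ-morphism = record
    { ⟦_⟧ = ofℤ K ; +-homo = ofℤ-+ ; *-homo = ofℤ-* ; -‿homo = ofℤ-neg
    ; 0-homo = refl ; 1-homo = +-identityʳ 1# }

  ofℤ-≟ : ∀ i j → Maybe (ofℤ K i ≈ ofℤ K j)
  ofℤ-≟ i j with i ℤ.≟ j
  ... | yes ≡.refl = just refl
  ... | no _       = nothing

  module Solver = Algebra.Solver.Ring ℤ.+-*-rawRing (fromCommutativeRing K) ofℤ-morphism ofℤ-≟

module Polynomials {c ℓ} (K : CommutativeRing c ℓ) where
  open CommutativeRing K
  open RingFacts K
  open Solver using (solve; _:=_; _:+_; _:*_; :-_; _:-_; con)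

  infix  4 _≃_
  infixl 7 _⊗_

  _≃_ : Poly K → Poly K → Set ℓ
  _≃_ = _≈P_ K

  _⊗_ : Poly K → Poly K → Poly K
  _⊗_ = _*P_ K

  eval : Poly K → Carrier → Carrier
  eval []      x = 0#
  eval (a ∷ p) x = a + x * eval p x

  convolve : (ℕ → Carrier) → (ℕ → Carrier) → ℕ → Carrier
  convolve f g zero    = f 0 * g 0
  convolve f g (suc k) = f 0 * g (suc k) + convolve (f ∘ suc) g k

  convolve-cong : ∀ {f f′ g g′} → (∀ i → f i ≈ f′ i) → (∀ i → g i ≈ g′ i) →
                  ∀ k → convolve f g k ≈ convolve f′ g′ k
  convolve-cong f≈ g≈ zero    = *-cong (f≈ 0) (g≈ 0)
  convolve-cong f≈ g≈ (suc k) = +-cong (*-cong (f≈ 0) (g≈ (suc k))) (convolve-cong (f≈ ∘ suc) g≈ k)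

  convolve-zeroˡ : ∀ {f} g → (∀ i → f i ≈ 0#) → ∀ k → convolve f g k ≈ 0#
  convolve-zeroˡ g f≈0 zero    = trans (*-congʳ (f≈0 0)) (zeroˡ _)
  convolve-zeroˡ g f≈0 (suc k) =
    trans (+-cong (trans (*-congʳ (f≈0 0)) (zeroˡ _)) (convolve-zeroˡ g (f≈0 ∘ suc) k)) (+-identityˡ _)

  convolve-linearˡ : ∀ {f u v} a h → (∀ i → f i ≈ a * u i + v i) →
                     ∀ k → convolve f h k ≈ a * convolve u h k + convolve v h k
  convolve-linearˡ {f} {u} {v} a h f≈ zero = trans (*-congʳ (f≈ 0))
    (solve 4 (λ a u v h → (a :* u :+ v) :* h := a :* (u :* h) :+ v :* h) refl a (u 0) (v 0) (h 0))
  convolve-linearˡ {f} {u} {v} a h f≈ (suc k) = trans (+-cong (*-congʳ (f≈ 0)) (convolve-linearˡ a h (f≈ ∘ suc) k))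
    (solve 6 (λ a u v h U V → (a :* u :+ v) :* h :+ (a :* U :+ V) := a :* (u :* h :+ U) :+ (v :* h :+ V)) refl
      a (u 0) (v 0) (h (suc k)) (convolve (u ∘ suc) h k) (convolve (v ∘ suc) h k))

  convolve-assoc : ∀ f g h k → convolve (convolve f g) h k ≈ convolve f (convolve g h) k
  convolve-assoc f g h zero    = *-assoc _ _ _
  convolve-assoc f g h (suc k) = begin
    convolve f g 0 * h (suc k) + convolve (convolve f g ∘ suc) h k
      ≈⟨ +-congˡ (convolve-linearˡ (f 0) h (λ i → refl) k) ⟩
    (f 0 * g 0) * h (suc k) + (f 0 * convolve (g ∘ suc) h k + convolve (convolve (f ∘ suc) g) h k)
      ≈⟨ +-congˡ (+-congˡ (convolve-assoc (f ∘ suc) g h k)) ⟩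
    (f 0 * g 0) * h (suc k) + (f 0 * convolve (g ∘ suc) h k + convolve (f ∘ suc) (convolve g h) k)
      ≈⟨ solve 5 (λ a b c X Y → (a :* b) :* c :+ (a :* X :+ Y) := a :* (b :* c :+ X) :+ Y) refl
           (f 0) (g 0) (h (suc k)) (convolve (g ∘ suc) h k) (convolve (f ∘ suc) (convolve g h) k) ⟩
    f 0 * (g 0 * h (suc k) + convolve (g ∘ suc) h k) + convolve (f ∘ suc) (convolve g h) k ∎

  coeff-+P : ∀ p q k → coeff K (_+P_ K p q) k ≈ coeff K p k + coeff K q k
  coeff-+P []      q       k       = sym (+-identityˡ _)
  coeff-+P (a ∷ p) []      k       = sym (+-identityʳ _)
  coeff-+P (a ∷ p) (b ∷ q) zero    = refl
  coeff-+P (a ∷ p) (b ∷ q) (suc k) = coeff-+P p q k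

  coeff-scale : ∀ a p k → coeff K (scale K a p) k ≈ a * coeff K p k
  coeff-scale a []      k       = sym (zeroʳ _)
  coeff-scale a (b ∷ p) zero    = refl
  coeff-scale a (b ∷ p) (suc k) = coeff-scale a p k

  coeff-⊗ : ∀ p q k → coeff K (p ⊗ q) k ≈ convolve (coeff K p) (coeff K q) k
  coeff-⊗ []      q k       = sym (convolve-zeroˡ (coeff K q) (λ i → refl) k)
  coeff-⊗ (a ∷ p) q zero    = trans (coeff-+P (scale K a q) _ 0) (trans (+-identityʳ _) (coeff-scale a q 0))
  coeff-⊗ (a ∷ p) q (suc k) = trans (coeff-+P (scale K a q) _ (suc k)) (+-cong (coeff-scale a q (suc k)) (coeff-⊗ p q k))

  ⊗-congˡ : ∀ p q q′ → q ≃ q′ → p ⊗ q ≃ p ⊗ q′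
  ⊗-congˡ p q q′ q≃ k = trans (coeff-⊗ p q k) (trans (convolve-cong (λ _ → refl) q≃ k) (sym (coeff-⊗ p q′ k)))

  ⊗-assoc : ∀ p q r → (p ⊗ q) ⊗ r ≃ p ⊗ (q ⊗ r)
  ⊗-assoc p q r k = begin
    coeff K ((p ⊗ q) ⊗ r) k                                  ≈⟨ coeff-⊗ (p ⊗ q) r k ⟩
    convolve (coeff K (p ⊗ q)) (coeff K r) k                 ≈⟨ convolve-cong (coeff-⊗ p q) (λ i → refl) k ⟩
    convolve (convolve (coeff K p) (coeff K q)) (coeff K r) k ≈⟨ convolve-assoc _ _ _ k ⟩
    convolve (coeff K p) (convolve (coeff K q) (coeff K r)) k ≈⟨ convolve-cong (λ i → refl) (coeff-⊗ q r) k ⟨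
    convolve (coeff K p) (coeff K (q ⊗ r)) k                 ≈⟨ coeff-⊗ p (q ⊗ r) k ⟨
    coeff K (p ⊗ (q ⊗ r)) k                                  ∎

  ⊗-identityˡ : ∀ p → (1# ∷ []) ⊗ p ≃ p
  ⊗-identityˡ p zero    = trans (coeff-⊗ (1# ∷ []) p 0) (*-identityˡ _)
  ⊗-identityˡ p (suc k) = trans (coeff-⊗ (1# ∷ []) p (suc k))
    (trans (+-cong (*-identityˡ _) (convolve-zeroˡ (coeff K p) (λ i → refl) k)) (+-identityʳ _))

  eval-+P : ∀ p q x → eval (_+P_ K p q) x ≈ eval p x + eval q x
  eval-+P []      q       x = sym (+-identityˡ _)
  eval-+P (a ∷ p) []      x = sym (+-identityʳ _)
  eval-+P (a ∷ p) (b ∷ q) x = trans (+-congˡ (*-congˡ (eval-+P p q x)))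
    (solve 5 (λ a b x P Q → (a :+ b) :+ x :* (P :+ Q) := (a :+ x :* P) :+ (b :+ x :* Q)) refl a b x (eval p x) (eval q x))

  eval-scale : ∀ a p x → eval (scale K a p) x ≈ a * eval p x
  eval-scale a []      x = sym (zeroʳ _)
  eval-scale a (b ∷ p) x = trans (+-congˡ (*-congˡ (eval-scale a p x)))
    (solve 4 (λ a b x P → a :* b :+ x :* (a :* P) := a :* (b :+ x :* P)) refl a b x (eval p x))

  eval-⊗ : ∀ p q x → eval (p ⊗ q) x ≈ eval p x * eval q x
  eval-⊗ []      q x = sym (zeroˡ _)
  eval-⊗ (a ∷ p) q x = begin
    eval (_+P_ K (scale K a q) (0# ∷ (p ⊗ q))) x      ≈⟨ eval-+P (scale K a q) _ x ⟩
    eval (scale K a q) x + (0# + x * eval (p ⊗ q) x)  ≈⟨ +-cong (eval-scale a q x) (+-congˡ (*-congˡ (eval-⊗ p q x))) ⟩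
    a * eval q x + (0# + x * (eval p x * eval q x))
      ≈⟨ solve 4 (λ a Q x P → a :* Q :+ (con (ℤ.+ 0) :+ x :* (P :* Q)) := (a :+ x :* P) :* Q) refl a (eval q x) x (eval p x) ⟩
    (a + x * eval p x) * eval q x                      ∎

  eval-≃[] : ∀ p x → p ≃ [] → eval p x ≈ 0#
  eval-≃[] []      x _   = refl
  eval-≃[] (a ∷ p) x p≃0 =
    trans (+-cong (p≃0 0) (*-congˡ (eval-≃[] p x (p≃0 ∘ suc)))) (trans (+-identityˡ _) (zeroʳ _))

  eval-cong : ∀ p q x → p ≃ q → eval p x ≈ eval q x
  eval-cong []      q       x p≃q = sym (eval-≃[] q x (sym ∘ p≃q))
  eval-cong (a ∷ p) []      x p≃q = eval-≃[] (a ∷ p) x p≃q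
  eval-cong (a ∷ p) (b ∷ q) x p≃q = +-cong (p≃q 0) (*-congˡ (eval-cong p q x (p≃q ∘ suc)))

  linear : Carrier → Poly K
  linear r = (- r) ∷ 1# ∷ []

  eval-linear : ∀ r x → eval (linear r) x ≈ x - r
  eval-linear r x = trans (+-congˡ (trans (*-congˡ (trans (+-congˡ (zeroʳ x)) (+-identityʳ 1#))) (*-identityʳ x))) (+-comm _ _)

  coeff-linear⊗ : ∀ r q k → coeff K (linear r ⊗ q) (suc k) ≈ - r * coeff K q (suc k) + coeff K q k
  coeff-linear⊗ r q k = trans (coeff-⊗ (linear r) q (suc k))
    (+-congˡ (trans (sym (coeff-⊗ (1# ∷ []) q k)) (⊗-identityˡ q k)))

  divide : ∀ r p → Σ (Poly K) λ q → ∀ k → coeff K p k ≈ coeff K (linear r ⊗ q) k + coeff K (eval p r ∷ []) k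
  divide r []      = [] , λ { zero → sym (+-identityˡ _) ; (suc zero) → sym (+-identityˡ _) ; (suc (suc k)) → sym (+-identityˡ _) }
  divide r (a ∷ p) with divide r p
  ... | q , p≈ = (eval p r ∷ q) , a∷p≈
    where
    a∷p≈ : ∀ k → coeff K (a ∷ p) k ≈ coeff K (linear r ⊗ (eval p r ∷ q)) k + coeff K (eval (a ∷ p) r ∷ []) k
    a∷p≈ zero          = trans (solve 3 (λ a r e → a := (:- r) :* e :+ (a :+ r :* e)) refl a r (eval p r))
                               (+-congʳ (sym (coeff-⊗ (linear r) (eval p r ∷ q) 0)))
    a∷p≈ (suc zero)    = trans (p≈ 0) (trans (+-congʳ (coeff-⊗ (linear r) q 0))
                               (trans (sym (+-identityʳ _)) (+-congʳ (sym (coeff-linear⊗ r (eval p r ∷ q) 0)))))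
    a∷p≈ (suc (suc k)) = trans (p≈ (suc k)) (trans (+-congʳ (coeff-linear⊗ r q k))
                               (+-congʳ (sym (coeff-linear⊗ r (eval p r ∷ q) (suc k)))))

  factor-theorem : ∀ r p → eval p r ≈ 0# → Σ (Poly K) λ q → p ≃ linear r ⊗ q
  factor-theorem r p p[r]≈0 with divide r p
  ... | q , p≈ = q , λ k → trans (p≈ k) (trans (+-congˡ (remainder≈0 k)) (+-identityʳ _))
    where
    remainder≈0 : ∀ k → coeff K (eval p r ∷ []) k ≈ 0#
    remainder≈0 zero    = p[r]≈0
    remainder≈0 (suc k) = refl

  linearProduct : (ℕ → Carrier) → List ℕ → Poly K
  linearProduct f = foldr (λ j acc → linear (f j) ⊗ acc) (1# ∷ [])

  linearProduct-root : ∀ f js j → j ∈ js → eval (linearProduct f js) (f j) ≈ 0#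
  linearProduct-root f (j ∷ js) j (here ≡.refl) = trans (eval-⊗ (linear (f j)) (linearProduct f js) (f j))
    (trans (*-congʳ (trans (eval-linear (f j) (f j)) (-‿inverseʳ _))) (zeroˡ _))
  linearProduct-root f (i ∷ js) j (there j∈js) = trans (eval-⊗ (linear (f i)) (linearProduct f js) (f j))
    (trans (*-congˡ (linearProduct-root f js j j∈js)) (zeroʳ _))

  ∣P⇒root : ∀ {f js p} → _∣P_ K (linearProduct f js) p → ∀ j → j ∈ js → eval p (f j) ≈ 0#
  ∣P⇒root {f} {js} {p} (q , p≃) j j∈js = trans (eval-cong p (linearProduct f js ⊗ q) (f j) p≃)
    (trans (eval-⊗ (linearProduct f js) q (f j)) (trans (*-congʳ (linearProduct-root f js j j∈js)) (zeroˡ _)))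

  module _ (cancel : ∀ {x y} → ¬ x ≈ 0# → x * y ≈ 0# → y ≈ 0#) where

    roots⇒∣P : ∀ {f js} → AllPairs (λ i j → ¬ f i ≈ f j) js → ∀ p → All (λ j → eval p (f j) ≈ 0#) js →
               _∣P_ K (linearProduct f js) p
    roots⇒∣P {f} {[]}     []             p []            = p , λ k → sym (⊗-identityˡ p k)
    roots⇒∣P {f} {j ∷ js} (j≉js ∷ js≉) p (p[j]≈0 ∷ zs) with factor-theorem (f j) p p[j]≈0
    ... | q , p≃ with roots⇒∣P js≉ q (All.zipWith root-of-q (j≉js , zs))
      where
      root-of-q : ∀ {i} → ¬ f j ≈ f i × eval p (f i) ≈ 0# → eval q (f i) ≈ 0#
      root-of-q {i} (j≉i , p[i]≈0) = cancel (λ fi-fj≈0 → j≉i (sym (x-y≈0⇒x≈y (trans (sym (eval-linear (f j) (f i))) fi-fj≈0))))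
        (trans (sym (eval-⊗ (linear (f j)) q _)) (trans (sym (eval-cong p (linear (f j) ⊗ q) _ p≃)) p[i]≈0))
    ...   | q′ , q≃ = q′ , λ k → begin
      coeff K p k                                        ≈⟨ p≃ k ⟩
      coeff K (linear (f j) ⊗ q) k                       ≈⟨ ⊗-congˡ (linear (f j)) q (linearProduct f js ⊗ q′) q≃ k ⟩
      coeff K (linear (f j) ⊗ (linearProduct f js ⊗ q′)) k ≈⟨ ⊗-assoc (linear (f j)) (linearProduct f js) q′ k ⟨
      coeff K (linearProduct f (j ∷ js) ⊗ q′) k          ∎

  eval-∷ʳ : ∀ cs a x → eval (cs List.∷ʳ a) x ≈ eval cs x + x ^ length cs * a
  eval-∷ʳ []       a x = trans (+-congˡ (zeroʳ x)) (trans (+-identityʳ a) (sym (trans (+-identityˡ _) (*-identityˡ a))))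
  eval-∷ʳ (b ∷ cs) a x = trans (+-congˡ (*-congˡ (eval-∷ʳ cs a x)))
    (solve 5 (λ b x E X a → b :+ x :* (E :+ X :* a) := (b :+ x :* E) :+ (x :* X) :* a) refl b x (eval cs x) (x ^ length cs) a)

  eval-reverse : ∀ {x y} → x * y ≈ 1# → ∀ cs → x * eval (reverse cs) x ≈ x ^ length cs * eval cs y
  eval-reverse {x} {y} xy≈1 []       = trans (zeroʳ x) (sym (zeroʳ _))
  eval-reverse {x} {y} xy≈1 (a ∷ cs) = begin
    x * eval (reverse (a ∷ cs)) x                 ≡⟨ ≡.cong (λ p → x * eval p x) (List.unfold-reverse a cs) ⟩
    x * eval (reverse cs List.∷ʳ a) x             ≈⟨ *-congˡ (eval-∷ʳ (reverse cs) a x) ⟩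
    x * (eval (reverse cs) x + x ^ length (reverse cs) * a)
                                                  ≡⟨ ≡.cong (λ n → x * (eval (reverse cs) x + x ^ n * a)) (List.length-reverse cs) ⟩
    x * (eval (reverse cs) x + X * a)             ≈⟨ distribˡ _ _ _ ⟩
    x * eval (reverse cs) x + x * (X * a)         ≈⟨ +-congʳ (eval-reverse xy≈1 cs) ⟩
    X * eval cs y + x * (X * a)                   ≈⟨ +-congʳ (*-congʳ (trans (sym (*-identityʳ X)) (*-congˡ (sym xy≈1)))) ⟩
    (X * (x * y)) * eval cs y + x * (X * a)
      ≈⟨ solve 5 (λ X x y E a → (X :* (x :* y)) :* E :+ x :* (X :* a) := (x :* X) :* (a :+ y :* E)) refl X x y (eval cs y) a ⟩
    (x * X) * (a + y * eval cs y)                 ∎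
    where
    X : Carrier
    X = x ^ length cs

  eval-tabulate : ∀ n (b : Fin n → Carrier) y → eval (tabulate b) y ≈ sumK K (tabulate (λ j → b j * y ^ toℕ j))
  eval-tabulate zero    b y = refl
  eval-tabulate (suc n) b y =
    +-cong (sym (*-identityʳ _)) (trans (*-congˡ (eval-tabulate n (b ∘ Fin.suc) y)) (y*∑ n (b ∘ Fin.suc) toℕ))
    where
    y*∑ : ∀ n (c : Fin n → Carrier) (e : Fin n → ℕ) →
          y * sumK K (tabulate (λ j → c j * y ^ e j)) ≈ sumK K (tabulate (λ j → c j * y ^ suc (e j)))
    y*∑ zero    c e = zeroʳ y
    y*∑ (suc n) c e = trans (distribˡ _ _ _)
      (+-cong (solve 3 (λ y c Y → y :* (c :* Y) := c :* (y :* Y)) refl y (c Fin.zero) _) (y*∑ n (c ∘ Fin.suc) (e ∘ Fin.suc)))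

module RootsOfUnity {c ℓ} (K : CommutativeRing c ℓ) where
  open CommutativeRing K
  open RingFacts K
  open Solver using (solve; _:=_; _:+_; _:*_; _:-_)

  1^n≈1 : ∀ n → 1# ^ n ≈ 1#
  1^n≈1 zero    = refl
  1^n≈1 (suc n) = trans (*-identityˡ _) (1^n≈1 n)

  geometric-sum : ∀ w n → (w - 1#) * ∑.fold n (w ^_) ≈ w ^ n - 1#
  geometric-sum w zero    = trans (zeroʳ _) (sym (-‿inverseʳ 1#))
  geometric-sum w (suc n) = begin
    (w - 1#) * (1# + ∑.fold n (λ i → w * w ^ i))  ≈⟨ *-congˡ (+-congˡ (∑.fold-homo (w *_) (zeroʳ w) (distribˡ w) n (w ^_))) ⟨
    (w - 1#) * (1# + w * G)                       ≈⟨ distribˡ _ _ _ ⟩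
    (w - 1#) * 1# + (w - 1#) * (w * G)            ≈⟨ +-cong (*-identityʳ _) (x*yz≈y*xz _ _ _) ⟩
    (w - 1#) + w * ((w - 1#) * G)                 ≈⟨ +-congˡ (*-congˡ (geometric-sum w n)) ⟩
    (w - 1#) + w * (w ^ n - 1#)                   ≈⟨ +-congˡ (trans (x[y-z]≈xy-xz _ _ _) (+-congˡ (-‿cong (*-identityʳ w)))) ⟩
    (w - 1#) + (w * w ^ n - w)                    ≈⟨ solve 3 (λ w o X → (w :- o) :+ (X :- w) := X :- o) refl w 1# (w * w ^ n) ⟩
    w * w ^ n - 1#                                ∎
    where
    G : Carrier
    G = ∑.fold n (w ^_)

  ∑-1 : ∀ n → ∑.fold n (λ _ → 1#) ≈ ofℕ K n
  ∑-1 zero    = refl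
  ∑-1 (suc n) = +-congˡ (∑-1 n)

  ^-swap : ∀ x m n → (x ^ m) ^ n ≈ (x ^ n) ^ m
  ^-swap x m n = trans (^-assocʳ x m n) (trans (reflexive (≡.cong (x ^_) (ℕ.*-comm m n))) (sym (^-assocʳ x n m)))

  [-1]^odd : ∀ t → ¬ 2 ∣ t → (- 1#) ^ t ≈ - 1#
  [-1]^odd zero          2∤0 = ⊥-elim (2∤0 (divides 0 ≡.refl))
  [-1]^odd (suc zero)    _   = *-identityʳ _
  [-1]^odd (suc (suc t)) 2∤t+2 = begin
    - 1# * (- 1# * (- 1#) ^ t)   ≈⟨ *-assoc _ _ _ ⟨
    (- 1# * - 1#) * (- 1#) ^ t   ≈⟨ *-congʳ (trans (-1*x≈-x _) (-‿involutive 1#)) ⟩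
    1# * (- 1#) ^ t              ≈⟨ *-identityˡ _ ⟩
    (- 1#) ^ t                   ≈⟨ [-1]^odd t (2∤t+2 ∘ ∣m∣n⇒∣m+n (∣-refl {2})) ⟩
    - 1#                         ∎

  module _ (N : ℕ) .{{_ : NonZero N}} where

    transform : (ℕ → Carrier) → Carrier → Carrier
    transform f v = ∑.fold N (λ i → f i * v ^ i)

    module _ {w} (w^N≈1 : w ^ N ≈ 1#) where

      ^-multiple≈1 : ∀ {t} → N ∣ t → w ^ t ≈ 1#
      ^-multiple≈1 (divides q ≡.refl) = begin
        w ^ (q ℕ.* N)  ≡⟨ ≡.cong (w ^_) (ℕ.*-comm q N) ⟩
        w ^ (N ℕ.* q)  ≈⟨ ^-assocʳ w N q ⟨
        (w ^ N) ^ q    ≈⟨ ^-congˡ q w^N≈1 ⟩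
        1# ^ q         ≈⟨ 1^n≈1 q ⟩
        1#             ∎

      ^-mod : ∀ n → w ^ n ≈ w ^ (n % N)
      ^-mod n = begin
        w ^ n                             ≡⟨ ≡.cong (w ^_) (m≡m%n+[m/n]*n n N) ⟩
        w ^ (n % N ℕ.+ (n / N) ℕ.* N)     ≈⟨ ^-homo-* w (n % N) _ ⟩
        w ^ (n % N) * w ^ ((n / N) ℕ.* N) ≈⟨ *-congˡ (^-multiple≈1 (divides (n / N) ≡.refl)) ⟩
        w ^ (n % N) * 1#                  ≈⟨ *-identityʳ _ ⟩
        w ^ (n % N)                       ∎

  module Domain (1≉0 : ¬ 1# ≈ 0#) (cancel : ∀ {x y} → ¬ x ≈ 0# → x * y ≈ 0# → y ≈ 0#) where

    ∑-powers≈0 : ∀ N .{{_ : NonZero N}} {w} → w ^ N ≈ 1# → ¬ w ≈ 1# → ∑.fold N (w ^_) ≈ 0#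
    ∑-powers≈0 N {w} w^N≈1 w≉1 = cancel (w≉1 ∘ x-y≈0⇒x≈y)
      (trans (geometric-sum w N) (trans (+-congʳ w^N≈1) (-‿inverseʳ _)))

    ∏-≉0 : ∀ {b} {A : Set b} (xs : List A) h → (∀ x → x ∈ xs → ¬ h x ≈ 0#) → ¬ foldr _*_ 1# (map h xs) ≈ 0#
    ∏-≉0 []       h h≉0 = 1≉0
    ∏-≉0 (x ∷ xs) h h≉0 ∏≈0 = ∏-≉0 xs h (λ y y∈xs → h≉0 y (there y∈xs)) (cancel (h≉0 x (here ≡.refl)) ∏≈0)

    x²≈1⇒x≈-1 : ∀ {x} → x * x ≈ 1# → ¬ x ≈ 1# → x ≈ - 1#
    x²≈1⇒x≈-1 {x} x²≈1 x≉1 = x-y≈0⇒x≈y (trans (+-congˡ (-‿involutive 1#)) (cancel (x≉1 ∘ x-y≈0⇒x≈y) (begin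
      (x - 1#) * (x + 1#) ≈⟨ solve 2 (λ x o → (x :- o) :* (x :+ o) := x :* x :- o :* o) refl x 1# ⟩
      x * x - 1# * 1#     ≈⟨ +-cong x²≈1 (-‿cong (*-identityˡ 1#)) ⟩
      1# - 1#             ≈⟨ -‿inverseʳ _ ⟩
      0#                  ∎)))

    module PrimitiveRoot (N : ℕ) .{{_ : NonZero N}} (ζ : Carrier) (prim : IsPrimitiveRoot K N ζ) where

      ζ^N≈1 : ζ ^ N ≈ 1#
      ζ^N≈1 = trans (reflexive (≡.sym (pow≡^ ζ N))) (proj₁ prim)

      ζ^k≉1 : ∀ k → 0 < k → k < N → ¬ ζ ^ k ≈ 1#
      ζ^k≉1 k 0<k k<N ζ^k≈1 = proj₂ prim k 0<k k<N (trans (reflexive (pow≡^ ζ k)) ζ^k≈1)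

      [ζ^t]^N≈1 : ∀ t → (ζ ^ t) ^ N ≈ 1#
      [ζ^t]^N≈1 t = trans (^-assocʳ ζ t N) (^-multiple≈1 N ζ^N≈1 (divides t ≡.refl))

      ζ^t≈1⇒N∣t : ∀ t → ζ ^ t ≈ 1# → N ∣ t
      ζ^t≈1⇒N∣t t ζ^t≈1 with t % N ℕ.≟ 0
      ... | yes t%N≡0 = m%n≡0⇒n∣m t N t%N≡0
      ... | no  t%N≢0 = ⊥-elim (ζ^k≉1 (t % N) (ℕ.n≢0⇒n>0 t%N≢0) (m%n<n t N) (trans (sym (^-mod N ζ^N≈1 t)) ζ^t≈1))

      ζ^t≉0 : ∀ t → ¬ ζ ^ t ≈ 0#
      ζ^t≉0 t ζ^t≈0 = 1≉0 (begin
        1#                     ≈⟨ [ζ^t]^N≈1 t ⟨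
        (ζ ^ t) ^ N            ≡⟨ ≡.cong ((ζ ^ t) ^_) (≡.sym (ℕ.suc-pred N)) ⟩
        (ζ ^ t) ^ suc (ℕ.pred N) ≈⟨ ^-congˡ (suc (ℕ.pred N)) ζ^t≈0 ⟩
        0# * 0# ^ ℕ.pred N     ≈⟨ zeroˡ _ ⟩
        0#                     ∎)

      ζ^-distinct : ∀ {i j} → i < j → j ℕ.∸ i < N → ¬ ζ ^ j ≈ ζ ^ i
      ζ^-distinct {i} {j} i<j j-i<N ζ^j≈ζ^i = ζ^k≉1 (j ℕ.∸ i) (ℕ.m<n⇒0<n∸m i<j) j-i<N
        (x-y≈0⇒x≈y (cancel (ζ^t≉0 i) (begin
          ζ ^ i * (ζ ^ (j ℕ.∸ i) - 1#)          ≈⟨ x[y-z]≈xy-xz _ _ _ ⟩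
          ζ ^ i * ζ ^ (j ℕ.∸ i) - ζ ^ i * 1#    ≈⟨ +-cong (^-homo-* ζ i (j ℕ.∸ i)) (-‿cong (sym (*-identityʳ _))) ⟨
          ζ ^ (i ℕ.+ (j ℕ.∸ i)) - ζ ^ i         ≡⟨ ≡.cong (λ k → ζ ^ k - ζ ^ i) (ℕ.m+[n∸m]≡n (ℕ.<⇒≤ i<j)) ⟩
          ζ ^ j - ζ ^ i                         ≈⟨ x≈y⇒x∙y⁻¹≈ε ζ^j≈ζ^i ⟩
          0#                                    ∎)))

      ζ^-injective : ∀ {i j} → i < N → j < N → ζ ^ i ≈ ζ ^ j → i ≡ j
      ζ^-injective {i} {j} i<N j<N ζ^i≈ζ^j with ℕ.<-cmp i j
      ... | tri< i<j _ _ = ⊥-elim (ζ^-distinct i<j (ℕ.≤-<-trans (ℕ.m∸n≤m j i) j<N) (sym ζ^i≈ζ^j))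
      ... | tri≈ _ i≡j _ = i≡j
      ... | tri> _ _ j<i = ⊥-elim (ζ^-distinct j<i (ℕ.≤-<-trans (ℕ.m∸n≤m i j) i<N) ζ^i≈ζ^j)

      ζ^[N∸h+i]≈1⇒i≡h : ∀ {h i} → h < N → i < N → ζ ^ ((N ℕ.∸ h) ℕ.+ i) ≈ 1# → i ≡ h
      ζ^[N∸h+i]≈1⇒i≡h {h} {i} h<N i<N ζ^[N∸h+i]≈1 = ζ^-injective i<N h<N (begin
        ζ ^ i                                  ≈⟨ *-identityˡ _ ⟨
        1# * ζ ^ i                             ≈⟨ *-congʳ ζ^N≈1 ⟨
        ζ ^ N * ζ ^ i                          ≈⟨ ^-homo-* ζ N i ⟨
        ζ ^ (N ℕ.+ i)                          ≡⟨ ≡.cong (λ n → ζ ^ (n ℕ.+ i)) (ℕ.m+[n∸m]≡n (ℕ.<⇒≤ h<N)) ⟨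
        ζ ^ (h ℕ.+ (N ℕ.∸ h) ℕ.+ i)            ≡⟨ ≡.cong (ζ ^_) (ℕ.+-assoc h (N ℕ.∸ h) i) ⟩
        ζ ^ (h ℕ.+ ((N ℕ.∸ h) ℕ.+ i))          ≈⟨ ^-homo-* ζ h _ ⟩
        ζ ^ h * ζ ^ ((N ℕ.∸ h) ℕ.+ i)          ≈⟨ *-congˡ ζ^[N∸h+i]≈1 ⟩
        ζ ^ h * 1#                             ≈⟨ *-identityʳ _ ⟩
        ζ ^ h                                  ∎)

      transform-inversion : ∀ f h → h < N → ∑.fold N (λ t → (ζ ^ t) ^ (N ℕ.∸ h) * transform N f (ζ ^ t)) ≈ ofℕ K N * f h
      transform-inversion f h h<N = begin
        ∑.fold N (λ t → (ζ ^ t) ^ (N ℕ.∸ h) * ∑.fold N (λ i → f i * (ζ ^ t) ^ i))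
          ≈⟨ ∑.fold-cong N (λ t _ → ∑.fold-homo ((ζ ^ t) ^ (N ℕ.∸ h) *_) (zeroʳ _) (distribˡ _) N _) ⟩
        ∑.fold N (λ t → ∑.fold N (λ i → (ζ ^ t) ^ (N ℕ.∸ h) * (f i * (ζ ^ t) ^ i)))
          ≈⟨ ∑.fold-comm N N _ ⟩
        ∑.fold N (λ i → ∑.fold N (λ t → (ζ ^ t) ^ (N ℕ.∸ h) * (f i * (ζ ^ t) ^ i)))
          ≈⟨ ∑.fold-cong N (λ i _ → ∑.fold-cong N (λ t _ → regroup i t)) ⟩
        ∑.fold N (λ i → ∑.fold N (λ t → f i * (ζ ^ ((N ℕ.∸ h) ℕ.+ i)) ^ t))
          ≈⟨ ∑.fold-cong N (λ i _ → sym (∑.fold-homo (f i *_) (zeroʳ _) (distribˡ _) N _)) ⟩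
        ∑.fold N (λ i → f i * ∑.fold N ((ζ ^ ((N ℕ.∸ h) ℕ.+ i)) ^_))
          ≈⟨ ∑.fold-single N h _ h<N off-diagonal ⟩
        f h * ∑.fold N ((ζ ^ ((N ℕ.∸ h) ℕ.+ h)) ^_)
          ≈⟨ *-congˡ (trans (∑.fold-cong N (λ t _ → trans (^-congˡ t ζ^[N∸h+h]≈1) (1^n≈1 t))) (∑-1 N)) ⟩
        f h * ofℕ K N
          ≈⟨ *-comm _ _ ⟩
        ofℕ K N * f h ∎
        where
        off-diagonal : ∀ i → i < N → i ≢ h → f i * ∑.fold N ((ζ ^ ((N ℕ.∸ h) ℕ.+ i)) ^_) ≈ 0#
        off-diagonal i i<N i≢h = trans
          (*-congˡ (∑-powers≈0 N ([ζ^t]^N≈1 ((N ℕ.∸ h) ℕ.+ i)) (i≢h ∘ ζ^[N∸h+i]≈1⇒i≡h h<N i<N))) (zeroʳ _)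
        ζ^[N∸h+h]≈1 : ζ ^ ((N ℕ.∸ h) ℕ.+ h) ≈ 1#
        ζ^[N∸h+h]≈1 = trans (reflexive (≡.cong (ζ ^_) (ℕ.m∸n+n≡m (ℕ.<⇒≤ h<N)))) ζ^N≈1
        regroup : ∀ i t → (ζ ^ t) ^ (N ℕ.∸ h) * (f i * (ζ ^ t) ^ i) ≈ f i * (ζ ^ ((N ℕ.∸ h) ℕ.+ i)) ^ t
        regroup i t = begin
          (ζ ^ t) ^ (N ℕ.∸ h) * (f i * (ζ ^ t) ^ i)  ≈⟨ x*yz≈y*xz _ _ _ ⟩
          f i * ((ζ ^ t) ^ (N ℕ.∸ h) * (ζ ^ t) ^ i)  ≈⟨ *-congˡ (^-homo-* (ζ ^ t) (N ℕ.∸ h) i) ⟨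
          f i * (ζ ^ t) ^ ((N ℕ.∸ h) ℕ.+ i)          ≈⟨ *-congˡ (^-swap ζ t ((N ℕ.∸ h) ℕ.+ i)) ⟩
          f i * (ζ ^ ((N ℕ.∸ h) ℕ.+ i)) ^ t          ∎

      ζ^[N/2]≈-1 : 2 ∣ N → ζ ^ (N / 2) ≈ - 1#
      ζ^[N/2]≈-1 2∣N = x²≈1⇒x≈-1
        (trans (sym (^-homo-* ζ (N / 2) (N / 2))) (trans (reflexive (≡.cong (ζ ^_) ([n/2]+[n/2]≡n 2∣N))) ζ^N≈1))
        (ζ^k≉1 (N / 2) (proj₁ (0<n/2<n 2∣N)) (proj₂ (0<n/2<n 2∣N)))

module MöbiusProduct {c ℓ} (K : CommutativeRing c ℓ) where
  open CommutativeRing K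
  open RingFacts K
  open Solver using (solve; _:=_; _:*_; :-_)

  primeProduct : (ℕ → Carrier) → ℕ → Carrier
  primeProduct h d = foldr _*_ 1# (map h (primeDivsPred d))

  primeProduct-range : ∀ h d n .{{_ : NonZero d}} → d ≤ n →
                       primeProduct h d ≈ ∏.fold n (λ k → ∏.when (primeDivisor? d (suc k)) (h k))
  primeProduct-range h d n d≤n = begin
    primeProduct h d                                                   ≈⟨ ∏.foldr-filter (primeDivisor? d ∘ suc) (upTo d) h ⟩
    foldr _*_ 1# (map (λ k → ∏.when (primeDivisor? d (suc k)) (h k)) (upTo d)) ≡⟨ ∏.foldr-applyUpTo d (λ k → k) _ ⟩
    ∏.fold d (λ k → ∏.when (primeDivisor? d (suc k)) (h k))            ≈⟨ ∏.fold-truncate d n _ d≤n beyond-d ⟨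
    ∏.fold n (λ k → ∏.when (primeDivisor? d (suc k)) (h k))            ∎
    where
    beyond-d : ∀ k → d ≤ k → k < n → ∏.when (primeDivisor? d (suc k)) (h k) ≈ 1#
    beyond-d k d≤k _ = ∏.when-no (primeDivisor? d (suc k)) (λ (_ , 1+k∣d) → ℕ.<⇒≱ (∣⇒≤ 1+k∣d) d≤k) _

  divisorSum-range : ∀ F M n .{{_ : NonZero M}} → M ≤ n →
                     sumK K (map F (divisors M)) ≈ ∑.fold n (λ i → ∑.when (suc i ∣? M) (F (suc i)))
  divisorSum-range F M n M≤n = begin
    sumK K (map F (divisors M))                                        ≈⟨ ∑.foldr-filter (_∣? M) (map suc (upTo M)) F ⟩
    sumK K (map (λ d → ∑.when (d ∣? M) (F d)) (map suc (upTo M)))      ≡⟨ ≡.cong (sumK K) (≡.sym (List.map-∘ (upTo M))) ⟩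
    sumK K (map (λ i → ∑.when (suc i ∣? M) (F (suc i))) (upTo M))      ≡⟨ ∑.foldr-applyUpTo M (λ i → i) _ ⟩
    ∑.fold M (λ i → ∑.when (suc i ∣? M) (F (suc i)))                   ≈⟨ ∑.fold-truncate M n _ M≤n beyond-M ⟨
    ∑.fold n (λ i → ∑.when (suc i ∣? M) (F (suc i)))                   ∎
    where
    beyond-M : ∀ i → M ≤ i → i < n → ∑.when (suc i ∣? M) (F (suc i)) ≈ 0#
    beyond-M i M≤i _ = ∑.when-no (suc i ∣? M) (λ 1+i∣M → ℕ.<⇒≱ (s≤s M≤i) (∣⇒≤ 1+i∣M)) _

  module _ {p e} (p-prime : Prime p) .{{_ : NonZero e}} where
    private instance
      p≢0 : NonZero p
      p≢0 = prime⇒nonZero p-prime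
      pe≢0 : NonZero (p ℕ.* e)
      pe≢0 = ℕ.m*n≢0 p e

    private
      pred-p<p*e : ℕ.pred p < p ℕ.* e
      pred-p<p*e = ℕ.<-≤-trans (ℕ.≤-reflexive (suc-pred-prime p-prime)) (ℕ.m≤m*n p e)

    primeProduct-*-∣ : ∀ h → p ∣ e → primeProduct h (p ℕ.* e) ≈ primeProduct h e
    primeProduct-*-∣ h p∣e = begin
      primeProduct h (p ℕ.* e)                                   ≈⟨ primeProduct-range h (p ℕ.* e) (p ℕ.* e) ℕ.≤-refl ⟩
      ∏.fold (p ℕ.* e) (λ k → ∏.when (primeDivisor? (p ℕ.* e) (suc k)) (h k))
        ≈⟨ ∏.fold-cong (p ℕ.* e) (λ k _ →
             ∏.when-cong (primeDivisor? (p ℕ.* e) (suc k)) (primeDivisor? e (suc k)) to (primeDivisor-*⁺ {p}) (λ _ → refl)) ⟩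
      ∏.fold (p ℕ.* e) (λ k → ∏.when (primeDivisor? e (suc k)) (h k)) ≈⟨ primeProduct-range h e (p ℕ.* e) (ℕ.m≤n*m e p) ⟨
      primeProduct h e                                           ∎
      where
      to : ∀ {q} → PrimeDivisor (p ℕ.* e) q → PrimeDivisor e q
      to pd with primeDivisor-*⁻ p-prime pd
      ... | inj₁ ≡.refl = proj₁ pd , p∣e
      ... | inj₂ pd′    = pd′

    primeProduct-*-∤ : ∀ h → ¬ p ∣ e → primeProduct h (p ℕ.* e) ≈ h (ℕ.pred p) * primeProduct h e
    primeProduct-*-∤ h p∤e = begin
      primeProduct h (p ℕ.* e)                                   ≈⟨ primeProduct-range h (p ℕ.* e) (p ℕ.* e) ℕ.≤-refl ⟩
      ∏.fold (p ℕ.* e) (λ k → ∏.when (primeDivisor? (p ℕ.* e) (suc k)) (h k))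
        ≈⟨ ∏.fold-update (p ℕ.* e) (ℕ.pred p) _ _ (h (ℕ.pred p)) pred-p<p*e other-k at-p ⟩
      h (ℕ.pred p) * ∏.fold (p ℕ.* e) (λ k → ∏.when (primeDivisor? e (suc k)) (h k))
        ≈⟨ *-congˡ (primeProduct-range h e (p ℕ.* e) (ℕ.m≤n*m e p)) ⟨
      h (ℕ.pred p) * primeProduct h e                             ∎
      where
      other-k : ∀ k → k < p ℕ.* e → k ≢ ℕ.pred p →
                ∏.when (primeDivisor? (p ℕ.* e) (suc k)) (h k) ≈ ∏.when (primeDivisor? e (suc k)) (h k)
      other-k k _ k≢ = ∏.when-cong (primeDivisor? (p ℕ.* e) (suc k)) (primeDivisor? e (suc k)) to (primeDivisor-*⁺ {p}) (λ _ → refl)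
        where
        to : PrimeDivisor (p ℕ.* e) (suc k) → PrimeDivisor e (suc k)
        to pd with primeDivisor-*⁻ p-prime pd
        ... | inj₁ 1+k≡p = ⊥-elim (k≢ (ℕ.suc-injective (≡.trans 1+k≡p (≡.sym (suc-pred-prime p-prime)))))
        ... | inj₂ pd′   = pd′
      at-p : ∏.when (primeDivisor? (p ℕ.* e) (suc (ℕ.pred p))) (h (ℕ.pred p))
             ≈ h (ℕ.pred p) * ∏.when (primeDivisor? e (suc (ℕ.pred p))) (h (ℕ.pred p))
      at-p = at (suc-pred-prime p-prime)
        where
        at : ∀ {q x} → q ≡ p → ∏.when (primeDivisor? (p ℕ.* e) q) x ≈ x * ∏.when (primeDivisor? e q) x
        at {q} {x} ≡.refl = begin
          ∏.when (primeDivisor? (p ℕ.* e) p) x ≈⟨ ∏.when-yes (primeDivisor? (p ℕ.* e) p) (p-prime , m∣m*n e) _ ⟩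
          x                                    ≈⟨ *-identityʳ _ ⟨
          x * 1#                               ≈⟨ *-congˡ (∏.when-no (primeDivisor? e p) (p∤e ∘ proj₂) _) ⟨
          x * ∏.when (primeDivisor? e p) x     ∎

  ofℤ-[-1]^length : ∀ (xs : List ℕ) → ofℤ K ((ℤ.- ℤ.1ℤ) ℤ.^ length xs) ≈ foldr _*_ 1# (map (λ _ → - 1#) xs)
  ofℤ-[-1]^length []       = +-identityʳ 1#
  ofℤ-[-1]^length (x ∷ xs) =
    trans (ofℤ-* (ℤ.- ℤ.1ℤ) ((ℤ.- ℤ.1ℤ) ℤ.^ length xs)) (*-cong (-‿cong (+-identityʳ 1#)) (ofℤ-[-1]^length xs))

  μ-squarefree-product : ∀ {d} → ¬ Squareful d → ofℤ K (μ d) ≈ primeProduct (λ _ → - 1#) d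
  μ-squarefree-product {d} ¬sq = begin
    ofℤ K (μ d)                                          ≡⟨ ≡.cong (ofℤ K) (μ-squarefree ¬sq) ⟩
    ofℤ K ((ℤ.- ℤ.1ℤ) ℤ.^ length (primeDivs d))
      ≡⟨ ≡.cong (λ n → ofℤ K ((ℤ.- ℤ.1ℤ) ℤ.^ n)) (List.length-map suc (primeDivsPred d)) ⟩
    ofℤ K ((ℤ.- ℤ.1ℤ) ℤ.^ length (primeDivsPred d))      ≈⟨ ofℤ-[-1]^length (primeDivsPred d) ⟩
    primeProduct (λ _ → - 1#) d                          ∎

  möbiusTerm : (ℕ → Carrier) → ℕ → Carrier
  möbiusTerm g d = ofℤ K (μ d) * primeProduct g d

  möbiusTerm-squareful : ∀ g {d} → Squareful d → möbiusTerm g d ≈ 0#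
  möbiusTerm-squareful g sq = trans (*-congʳ (reflexive (≡.cong (ofℤ K) (μ-squareful sq)))) (zeroˡ _)

  möbiusTerm-* : ∀ g {p e} → Prime p → .{{_ : NonZero e}} → ¬ p ∣ e → möbiusTerm g (p ℕ.* e) ≈ - g (ℕ.pred p) * möbiusTerm g e
  möbiusTerm-* g {p} {e} p-prime p∤e = by-squarefreeness (squareful? e)
    where
    by-squarefreeness : Dec (Squareful e) → möbiusTerm g (p ℕ.* e) ≈ - g (ℕ.pred p) * möbiusTerm g e
    by-squarefreeness (yes sq) = trans (möbiusTerm-squareful g (squareful-* p-prime sq))
                                       (sym (trans (*-congˡ (möbiusTerm-squareful g sq)) (zeroʳ _)))
    by-squarefreeness (no ¬sq) = begin
      ofℤ K (μ (p ℕ.* e)) * primeProduct g (p ℕ.* e)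
        ≈⟨ *-cong (μ-squarefree-product (¬sq ∘ squareful-*⁻ p-prime p∤e)) (primeProduct-*-∤ p-prime g p∤e) ⟩
      primeProduct (λ _ → - 1#) (p ℕ.* e) * (g (ℕ.pred p) * primeProduct g e)
        ≈⟨ *-congʳ (primeProduct-*-∤ p-prime (λ _ → - 1#) p∤e) ⟩
      (- 1# * primeProduct (λ _ → - 1#) e) * (g (ℕ.pred p) * primeProduct g e)
        ≈⟨ *-congʳ (-1*x≈-x _) ⟩
      (- primeProduct (λ _ → - 1#) e) * (g (ℕ.pred p) * primeProduct g e)
        ≈⟨ solve 3 (λ s x y → (:- s) :* (x :* y) := (:- x) :* (s :* y)) refl _ _ _ ⟩
      - g (ℕ.pred p) * (primeProduct (λ _ → - 1#) e * primeProduct g e)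
        ≈⟨ *-congˡ (*-congʳ (μ-squarefree-product ¬sq)) ⟨
      - g (ℕ.pred p) * möbiusTerm g e ∎

  divisorSum : (ℕ → Carrier) → ℕ → Carrier
  divisorSum g M = sumK K (map (möbiusTerm g) (divisors M))

  module _ (g : ℕ → Carrier) {p M} (p-prime : Prime p) .{{_ : NonZero M}} where
    private instance
      p≢0 : NonZero p
      p≢0 = prime⇒nonZero p-prime
      pM≢0 : NonZero (p ℕ.* M)
      pM≢0 = ℕ.m*n≢0 p M

    private
      term : ℕ → ℕ → Carrier
      term n i = ∑.when (suc i ∣? n) (möbiusTerm g (suc i))

    divisorSum-*-∣ : p ∣ M → divisorSum g (p ℕ.* M) ≈ divisorSum g M
    divisorSum-*-∣ p∣M = begin
      divisorSum g (p ℕ.* M)           ≈⟨ divisorSum-range (möbiusTerm g) (p ℕ.* M) (p ℕ.* M) ℕ.≤-refl ⟩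
      ∑.fold (p ℕ.* M) (term (p ℕ.* M)) ≈⟨ ∑.fold-cong (p ℕ.* M) (λ i _ → same-term (suc i)) ⟩
      ∑.fold (p ℕ.* M) (term M)         ≈⟨ divisorSum-range (möbiusTerm g) M (p ℕ.* M) (ℕ.m≤n*m M p) ⟨
      divisorSum g M                   ∎
      where
      same-term : ∀ d .{{_ : NonZero d}} → ∑.when (d ∣? p ℕ.* M) (möbiusTerm g d) ≈ ∑.when (d ∣? M) (möbiusTerm g d)
      same-term d with d ∣? p ℕ.* M | d ∣? M
      ... | yes _    | yes _   = refl
      ... | yes d∣pM | no  d∤M = möbiusTerm-squareful g (squareful⁺ p-prime (p²∣new-divisor p-prime p∣M d∣pM d∤M))
      ... | no  d∤pM | yes d∣M = ⊥-elim (d∤pM (∣n⇒∣m*n p d∣M))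
      ... | no  _    | no  _   = refl

    divisorSum-*-∤ : ¬ p ∣ M → divisorSum g (p ℕ.* M) ≈ (1# - g (ℕ.pred p)) * divisorSum g M
    divisorSum-*-∤ p∤M = begin
      divisorSum g (p ℕ.* M)
        ≈⟨ divisorSum-range (möbiusTerm g) (p ℕ.* M) (p ℕ.* M) ℕ.≤-refl ⟩
      ∑.fold (p ℕ.* M) (term (p ℕ.* M))
        ≈⟨ ∑.fold-cong (p ℕ.* M) (λ i _ → split-term (suc i)) ⟩
      ∑.fold (p ℕ.* M) (λ i → term M i + ∑.when (p ∣? suc i) (pM-term (suc i)))
        ≈⟨ ∑.fold-∙ (p ℕ.* M) _ _ ⟩
      ∑.fold (p ℕ.* M) (term M) + ∑.fold (p ℕ.* M) (λ i → ∑.when (p ∣? suc i) (pM-term (suc i)))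
        ≈⟨ +-cong (divisorSum-range (möbiusTerm g) M (p ℕ.* M) (ℕ.m≤n*m M p)) (sym (∑.fold-multiples p M pM-term)) ⟨
      divisorSum g M + ∑.fold M (λ j → pM-term (p ℕ.* suc j))
        ≈⟨ +-congˡ (∑.fold-cong M (λ j _ → pM-term-p* (suc j))) ⟩
      divisorSum g M + ∑.fold M (λ j → - g (ℕ.pred p) * term M j)
        ≈⟨ +-congˡ (∑.fold-homo (- g (ℕ.pred p) *_) (zeroʳ _) (distribˡ _) M (term M)) ⟨
      divisorSum g M + - g (ℕ.pred p) * ∑.fold M (term M)
        ≈⟨ +-congˡ (*-congˡ (divisorSum-range (möbiusTerm g) M M ℕ.≤-refl)) ⟨
      divisorSum g M + - g (ℕ.pred p) * divisorSum g M
        ≈⟨ +-congʳ (*-identityˡ _) ⟨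
      1# * divisorSum g M + - g (ℕ.pred p) * divisorSum g M
        ≈⟨ distribʳ _ _ _ ⟨
      (1# - g (ℕ.pred p)) * divisorSum g M ∎
      where
      pM-term : ℕ → Carrier
      pM-term d = ∑.when (d ∣? p ℕ.* M) (möbiusTerm g d)
      split-term : ∀ d → pM-term d ≈ ∑.when (d ∣? M) (möbiusTerm g d) + ∑.when (p ∣? d) (pM-term d)
      split-term d with p ∣? d
      ... | yes p∣d = trans (sym (+-identityˡ _)) (+-congʳ (sym (∑.when-no (d ∣? M) (p∤M ∘ ∣-trans p∣d) _)))
      ... | no  p∤d = trans (∑.when-cong (d ∣? p ℕ.* M) (d ∣? M) (prime∤∧∣p*⇒∣ p-prime p∤d) (∣n⇒∣m*n p) (λ _ → refl))
                            (sym (+-identityʳ _))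
      pM-term-p* : ∀ e → pM-term (p ℕ.* e) ≈ - g (ℕ.pred p) * ∑.when (e ∣? M) (möbiusTerm g e)
      pM-term-p* e = trans
        (∑.when-cong (p ℕ.* e ∣? p ℕ.* M) (e ∣? M) (*-cancelˡ-∣ p) (*-monoʳ-∣ p)
          (λ e∣M → möbiusTerm-* g p-prime {{∣⇒nonZero e∣M}} (p∤M ∘ flip ∣-trans e∣M)))
        (sym (∑.when-homo (- g (ℕ.pred p) *_) (zeroʳ _) (e ∣? M) _))

  möbius-product : ∀ g M .{{_ : NonZero M}} → divisorSum g M ≈ primeProduct (λ k → 1# - g k) M
  möbius-product g = <-rec (λ M → .{{_ : NonZero M}} → divisorSum g M ≈ primeProduct h M) step
    where
    h : ℕ → Carrier
    h k = 1# - g k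
    step : ∀ M → WfRec _<_ (λ M → .{{_ : NonZero M}} → divisorSum g M ≈ primeProduct h M) M →
           .{{_ : NonZero M}} → divisorSum g M ≈ primeProduct h M
    step 1               _  = trans (+-identityʳ _) (trans (*-identityʳ _) (+-identityʳ _))
    step M@(suc (suc _)) ih with prime-factor M (s≤s (s≤s z≤n))
    ... | p , p-prime , p∣M =
      ≡.subst (λ n → divisorSum g n ≈ primeProduct h n) (≡.sym (m∣n⇒n≡m*quotient p∣M)) (by-cases (p ∣? M′))
      where
      M′ : ℕ
      M′ = quotient p∣M
      instance
        M′≢0 : NonZero M′
        M′≢0 = quotient≢0 p∣M
      ih′ : divisorSum g M′ ≈ primeProduct h M′
      ih′ = ih (quotient-< p∣M {{prime⇒nonTrivial p-prime}})
      by-cases : Dec (p ∣ M′) → divisorSum g (p ℕ.* M′) ≈ primeProduct h (p ℕ.* M′)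
      by-cases (yes p∣M′) = trans (divisorSum-*-∣ g p-prime p∣M′) (trans ih′ (sym (primeProduct-*-∣ p-prime h p∣M′)))
      by-cases (no  p∤M′) = trans (divisorSum-*-∤ g p-prime p∤M′) (trans (*-congˡ ih′) (sym (primeProduct-*-∤ p-prime h p∤M′)))

module Criterion {c ℓ} (K : CommutativeRing c ℓ) (m : ℕ) (a : Fin (suc m) → CommutativeRing.Carrier K)
                 (N : ℕ) .{{_ : NonZero N}} where
  open CommutativeRing K
  open RingFacts K
  open RootsOfUnity K
  open MöbiusProduct K

  reciprocal : Carrier → Carrier
  reciprocal v = sumK K (map (λ j → a j * v ^ toℕ j) (allFin (suc m)))

  module _ {v} (v^N≈1 : v ^ N ≈ 1#) where

    transform-congSum : ∀ s → transform N (congSum K m N a s) v ≈ v ^ s * reciprocal v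
    transform-congSum s = begin
      ∑.fold N (λ h → sumK K (map a (filter (residue? h) (allFin (suc m)))) * v ^ h)
        ≈⟨ ∑.fold-cong N (λ h _ → *-congʳ (∑.foldr-filter (residue? h) (allFin (suc m)) a)) ⟩
      ∑.fold N (λ h → sumK K (map (λ j → ∑.when (residue? h j) (a j)) (allFin (suc m))) * v ^ h)
        ≈⟨ ∑.fold-cong N (λ h _ → ∑.foldr-homo (_* v ^ h) (zeroˡ _) (λ x y → distribʳ _ x y) (allFin (suc m)) _) ⟩
      ∑.fold N (λ h → sumK K (map (λ j → ∑.when (residue? h j) (a j) * v ^ h) (allFin (suc m))))
        ≈⟨ ∑.fold-foldr-comm N (allFin (suc m)) _ ⟩
      sumK K (map (λ j → ∑.fold N (λ h → ∑.when (residue? h j) (a j) * v ^ h)) (allFin (suc m)))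
        ≈⟨ ∑.foldr-map-cong (allFin (suc m)) (λ j _ → one-residue j) ⟩
      sumK K (map (λ j → v ^ s * (a j * v ^ toℕ j)) (allFin (suc m)))
        ≈⟨ ∑.foldr-homo (v ^ s *_) (zeroʳ _) (distribˡ _) (allFin (suc m)) _ ⟨
      v ^ s * reciprocal v ∎
      where
      residue? : ∀ h (j : Fin (suc m)) → Dec ((toℕ j ℕ.+ s) % N ≡ h)
      residue? h j = ((toℕ j ℕ.+ s) % N) ℕ.≟ h
      one-residue : ∀ j → ∑.fold N (λ h → ∑.when (residue? h j) (a j) * v ^ h) ≈ v ^ s * (a j * v ^ toℕ j)
      one-residue j = begin
        ∑.fold N (λ h → ∑.when (residue? h j) (a j) * v ^ h)
          ≈⟨ ∑.fold-single N r _ (m%n<n _ N) (λ h _ r≢h →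
               trans (*-congʳ (∑.when-no (residue? h j) (r≢h ∘ ≡.sym) _)) (zeroˡ _)) ⟩
        ∑.when (residue? r j) (a j) * v ^ r ≈⟨ *-cong (sym (∑.when-yes (residue? r j) ≡.refl _)) (^-mod N v^N≈1 _) ⟨
        a j * v ^ (toℕ j ℕ.+ s)             ≈⟨ *-congˡ (^-homo-* v (toℕ j) s) ⟩
        a j * (v ^ toℕ j * v ^ s)           ≈⟨ trans (*-congˡ (*-comm _ _)) (x*yz≈y*xz _ _ _) ⟩
        v ^ s * (a j * v ^ toℕ j)           ∎
        where
        r : ℕ
        r = (toℕ j ℕ.+ s) % N

  möbiusWeight : Carrier → Carrier
  möbiusWeight v = sumK K (map (λ d → ofℤ K (μ d) * v ^ shift N d) (divisors N))

  möbiusWeight-product : ∀ v → möbiusWeight v ≈ primeProduct (λ k → 1# - v ^ (N / suc k)) N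
  möbiusWeight-product v = trans
    (∑.foldr-map-cong (divisors N) (λ d _ → *-congˡ (^-sum v (λ k → N / suc k) (primeDivsPred d))))
    (möbius-product (λ k → v ^ (N / suc k)) N)

  transform-criterion : ∀ {v} → v ^ N ≈ 1# → transform N (criterion K m N a) v ≈ möbiusWeight v * reciprocal v
  transform-criterion {v} v^N≈1 = begin
    ∑.fold N (λ h → sumK K (map (λ d → ofℤ K (μ d) * congSum K m N a (shift N d) h) (divisors N)) * v ^ h)
      ≈⟨ ∑.fold-cong N (λ h _ → ∑.foldr-homo (_* v ^ h) (zeroˡ _) (λ x y → distribʳ _ x y) (divisors N) _) ⟩
    ∑.fold N (λ h → sumK K (map (λ d → (ofℤ K (μ d) * congSum K m N a (shift N d) h) * v ^ h) (divisors N)))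
      ≈⟨ ∑.fold-foldr-comm N (divisors N) _ ⟩
    sumK K (map (λ d → ∑.fold N (λ h → (ofℤ K (μ d) * congSum K m N a (shift N d) h) * v ^ h)) (divisors N))
      ≈⟨ ∑.foldr-map-cong (divisors N) (λ d _ → term d) ⟩
    sumK K (map (λ d → (ofℤ K (μ d) * v ^ shift N d) * reciprocal v) (divisors N))
      ≈⟨ ∑.foldr-homo (_* reciprocal v) (zeroˡ _) (λ x y → distribʳ _ x y) (divisors N) _ ⟨
    möbiusWeight v * reciprocal v ∎
    where
    term : ∀ d → ∑.fold N (λ h → (ofℤ K (μ d) * congSum K m N a (shift N d) h) * v ^ h)
                 ≈ (ofℤ K (μ d) * v ^ shift N d) * reciprocal v
    term d = begin
      ∑.fold N (λ h → (ofℤ K (μ d) * congSum K m N a (shift N d) h) * v ^ h)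
        ≈⟨ ∑.fold-cong N (λ h _ → *-assoc _ _ _) ⟩
      ∑.fold N (λ h → ofℤ K (μ d) * (congSum K m N a (shift N d) h * v ^ h))
        ≈⟨ ∑.fold-homo (ofℤ K (μ d) *_) (zeroʳ _) (distribˡ _) N _ ⟨
      ofℤ K (μ d) * transform N (congSum K m N a (shift N d)) v
        ≈⟨ *-congˡ (transform-congSum v^N≈1 (shift N d)) ⟩
      ofℤ K (μ d) * (v ^ shift N d * reciprocal v)
        ≈⟨ *-assoc _ _ _ ⟨
      (ofℤ K (μ d) * v ^ shift N d) * reciprocal v ∎

  module WithPrimitiveRoot (F : IsCharZeroField K) (ζ : Carrier) (prim : IsPrimitiveRoot K N ζ) where
    open IsCharZeroField F
    open Polynomials K using (eval; eval-reverse; eval-tabulate; ∣P⇒root; roots⇒∣P)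

    cancel : ∀ {x y} → ¬ x ≈ 0# → x * y ≈ 0# → y ≈ 0#
    cancel = field-cancel F

    open Domain 1≉0 cancel
    open PrimitiveRoot N ζ prim

    reciprocal-reflect : ∀ {x y} → x * y ≈ 1# → x * eval (polyOf K m a) x ≈ x ^ suc m * reciprocal y
    reciprocal-reflect {x} {y} xy≈1 = begin
      x * eval (polyOf K m a) x                        ≈⟨ eval-reverse xy≈1 (map a (allFin (suc m))) ⟩
      x ^ List.length (map a (allFin (suc m))) * eval (map a (allFin (suc m))) y
        ≡⟨ ≡.cong₂ (λ n cs → x ^ n * eval cs y)
             (≡.trans (List.length-map a (allFin (suc m))) (List.length-tabulate {n = suc m} (λ j → j)))
             (List.map-tabulate (λ j → j) a) ⟩
      x ^ suc m * eval (List.tabulate a) y            ≈⟨ *-congˡ (eval-tabulate (suc m) a y) ⟩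
      x ^ suc m * sumK K (List.tabulate (λ j → a j * y ^ toℕ j))
        ≡⟨ ≡.cong (λ cs → x ^ suc m * sumK K cs) (List.map-tabulate (λ j → j) (λ j → a j * y ^ toℕ j)) ⟨
      x ^ suc m * reciprocal y ∎

    möbiusWeight-coprime : ∀ t → gcd t N ≡ 1 → ¬ möbiusWeight (ζ ^ t) ≈ 0#
    möbiusWeight-coprime t coprime W≈0 =
      ∏-≉0 (primeDivsPred N) _ factor≉0 (trans (sym (möbiusWeight-product (ζ ^ t))) W≈0)
      where
      factor≉0 : ∀ k → k ∈ primeDivsPred N → ¬ 1# - (ζ ^ t) ^ (N / suc k) ≈ 0#
      factor≉0 k k∈ factor≈0 = ℕ.<⇒≢ (1<prime p-prime) (≡.sym (gcd≡1⇒coprime {t} {N} coprime (p∣t , p∣N)))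
        where
        p-prime : Prime (suc k)
        p-prime = proj₁ (∈-primeDivsPred⁻ {N} k∈)
        p∣N : suc k ∣ N
        p∣N = proj₂ (∈-primeDivsPred⁻ {N} k∈)
        p∣t : suc k ∣ t
        p∣t = m∣n∧n∣o*[n/m]⇒m∣o p∣N (ζ^t≈1⇒N∣t _ (trans (sym (^-assocʳ ζ t _)) (sym (x-y≈0⇒x≈y factor≈0))))

    möbiusWeight-common : ∀ {t p} → Prime p → p ∣ t → p ∣ N → möbiusWeight (ζ ^ t) ≈ 0#
    möbiusWeight-common {t} {p} p-prime p∣t p∣N = trans (möbiusWeight-product (ζ ^ t))
      (∏-≈0 (primeDivsPred N) _ (∈-primeDivsPred⁺ (p-prime , p∣N)) factor≈0)
      where
      1+k≡p : suc (ℕ.pred p) ≡ p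
      1+k≡p = suc-pred-prime p-prime
      factor≈0 : 1# - (ζ ^ t) ^ (N / suc (ℕ.pred p)) ≈ 0#
      factor≈0 = x≈y⇒x∙y⁻¹≈ε (sym (trans (^-assocʳ ζ t _) (^-multiple≈1 N ζ^N≈1
        (m∣n∧m∣o⇒n∣o*[n/m] (≡.subst (_∣ N) (≡.sym 1+k≡p) p∣N) (≡.subst (_∣ t) (≡.sym 1+k≡p) p∣t)))))

    ζ^[N∸k]*ζ^k≈1 : ∀ {k} → k ≤ N → ζ ^ (N ℕ.∸ k) * ζ ^ k ≈ 1#
    ζ^[N∸k]*ζ^k≈1 {k} k≤N =
      trans (sym (^-homo-* ζ (N ℕ.∸ k) k)) (trans (reflexive (≡.cong (ζ ^_) (ℕ.m∸n+n≡m k≤N))) ζ^N≈1)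

    RootsAtCoprimePowers : Set ℓ
    RootsAtCoprimePowers = ∀ k → k ∈ coprimes N → eval (polyOf K m a) (ζ ^ k) ≈ 0#

    ReciprocalVanishes : Set ℓ
    ReciprocalVanishes = ∀ t → t < N → gcd t N ≡ 1 → reciprocal (ζ ^ t) ≈ 0#

    cyclotomic-∣P⇔roots : _∣P_ K (cyclotomic K N ζ) (polyOf K m a) ⇔ RootsAtCoprimePowers
    cyclotomic-∣P⇔roots = mk⇔
      (λ Φ∣P k k∈ → trans (reflexive (≡.cong (eval P) (≡.sym (pow≡^ ζ k)))) (∣P⇒root {pow K ζ} {coprimes N} {P} Φ∣P k k∈))
      (λ roots → roots⇒∣P cancel distinct P
        (All.tabulate (λ {k} k∈ → trans (reflexive (≡.cong (eval P) (pow≡^ ζ k))) (roots k k∈))))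
      where
      P : Poly K
      P = polyOf K m a
      distinct : AllPairs (λ i j → ¬ pow K ζ i ≈ pow K ζ j) (coprimes N)
      distinct = AllPairs.filter⁺ _ (AllPairs.map⁺ (AllPairs.applyUpTo⁺₁ (λ i → i) N λ {i} {j} i<j j<N ζ^i≈ζ^j →
        ζ^-distinct (ℕ.s≤s i<j) (ℕ.≤-<-trans (ℕ.m∸n≤m j i) j<N)
          (sym (trans (reflexive (≡.sym (pow≡^ ζ (suc i)))) (trans ζ^i≈ζ^j (reflexive (pow≡^ ζ (suc j))))))))

    roots⇔reciprocalVanishes : RootsAtCoprimePowers ⇔ ReciprocalVanishes
    roots⇔reciprocalVanishes = mk⇔
      (λ roots t t<N coprime → let k = N ℕ.∸ t in
        cancel (λ x^[m+1]≈0 → ζ^t≉0 (k ℕ.* suc m) (trans (sym (^-assocʳ ζ k (suc m))) x^[m+1]≈0))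
          (trans (sym (reciprocal-reflect (ζ^[N∸k]*ζ^k≈1 (ℕ.<⇒≤ t<N))))
            (trans (*-congˡ (roots k (∈-coprimes⁺ (ℕ.m<n⇒0<n∸m t<N) (ℕ.m∸n≤m N t) (coprime-∸ (ℕ.<⇒≤ t<N) coprime))))
              (zeroʳ _))))
      (λ vanishes k k∈ → let (0<k , k≤N , coprime) = ∈-coprimes⁻ k∈ in
        cancel (ζ^t≉0 k)
          (trans (reciprocal-reflect (trans (*-comm _ _) (ζ^[N∸k]*ζ^k≈1 k≤N)))
            (trans (*-congˡ (vanishes (N ℕ.∸ k) (ℕ.∸-monoʳ-< 0<k k≤N) (coprime-∸ k≤N coprime))) (zeroʳ _))))

    N≉0 : ¬ ofℕ K N ≈ 0#
    N≉0 N≈0 = char0 (ℕ.pred N) (trans (reflexive (≡.cong (ofℕ K) (ℕ.suc-pred N))) N≈0)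

    ĉ : ℕ → Carrier
    ĉ t = transform N (criterion K m N a) (ζ ^ t)

    ĉ≈weight*reciprocal : ∀ t → ĉ t ≈ möbiusWeight (ζ ^ t) * reciprocal (ζ ^ t)
    ĉ≈weight*reciprocal t = transform-criterion ([ζ^t]^N≈1 t)

    criterion⇔reciprocalVanishes : (∀ h → h < N → criterion K m N a h ≈ 0#) ⇔ ReciprocalVanishes
    criterion⇔reciprocalVanishes = mk⇔
      (λ criterion≈0 t _ coprime → cancel (möbiusWeight-coprime t coprime) (trans (sym (ĉ≈weight*reciprocal t))
        (∑.fold-ε N (λ h h<N → trans (*-congʳ (criterion≈0 h h<N)) (zeroˡ _)))))
      (λ vanishes h h<N → cancel N≉0 (trans (sym (transform-inversion (criterion K m N a) h h<N))
        (∑.fold-ε N (λ t t<N → trans (*-congˡ (ĉ≈0 vanishes t t<N)) (zeroʳ _)))))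
      where
      ĉ≈0 : ReciprocalVanishes → ∀ t → t < N → ĉ t ≈ 0#
      ĉ≈0 vanishes t t<N with gcd t N ℕ.≟ 1
      ... | yes coprime = trans (ĉ≈weight*reciprocal t) (trans (*-congˡ (vanishes t t<N coprime)) (zeroʳ _))
      ... | no ¬coprime with common-prime-divisor t N ¬coprime
      ...   | p , p-prime , p∣t , p∣N =
        trans (ĉ≈weight*reciprocal t) (trans (*-congʳ (möbiusWeight-common p-prime p∣t p∣N)) (zeroˡ _))

    module _ (2∣N : 2 ∣ N) where
      private
        H : ℕ
        H = N / 2

      -- only odd t contribute to the inversion formula, and for them ζ^{tN/2} = -1
      ζ^[tN/2]*ĉ≈-ĉ : ∀ t → (ζ ^ t) ^ H * ĉ t ≈ - ĉ t
      ζ^[tN/2]*ĉ≈-ĉ t with 2 ∣? t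
      ... | yes 2∣t = trans (*-congˡ ĉ≈0) (trans (zeroʳ _) (sym (trans (-‿cong ĉ≈0) -0#≈0#)))
        where
        ĉ≈0 : ĉ t ≈ 0#
        ĉ≈0 = trans (ĉ≈weight*reciprocal t) (trans (*-congʳ (möbiusWeight-common prime[2] 2∣t 2∣N)) (zeroˡ _))
      ... | no  2∤t = trans (*-congʳ ζ^tH≈-1) (-1*x≈-x _)
        where
        ζ^tH≈-1 : (ζ ^ t) ^ H ≈ - 1#
        ζ^tH≈-1 = trans (^-swap ζ t H) (trans (^-congˡ t (ζ^[N/2]≈-1 2∣N)) ([-1]^odd t 2∤t))

      criterion-antiperiodic : ∀ h → h ℕ.+ H < N → ofℕ K N * criterion K m N a h ≈ - (ofℕ K N * criterion K m N a (h ℕ.+ H))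
      criterion-antiperiodic h h+H<N = begin
        ofℕ K N * criterion K m N a h
          ≈⟨ transform-inversion _ h (ℕ.≤-<-trans (ℕ.m≤m+n h H) h+H<N) ⟨
        ∑.fold N (λ t → (ζ ^ t) ^ (N ℕ.∸ h) * ĉ t)
          ≈⟨ ∑.fold-cong N (λ t _ → split-weight t) ⟩
        ∑.fold N (λ t → - ((ζ ^ t) ^ (N ℕ.∸ (h ℕ.+ H)) * ĉ t))
          ≈⟨ ∑.fold-homo -_ -0#≈0# (λ x y → sym (⁻¹-∙-comm x y)) N _ ⟨
        - ∑.fold N (λ t → (ζ ^ t) ^ (N ℕ.∸ (h ℕ.+ H)) * ĉ t)
          ≈⟨ -‿cong (transform-inversion _ (h ℕ.+ H) h+H<N) ⟩
        - (ofℕ K N * criterion K m N a (h ℕ.+ H)) ∎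
        where
        split-weight : ∀ t → (ζ ^ t) ^ (N ℕ.∸ h) * ĉ t ≈ - ((ζ ^ t) ^ (N ℕ.∸ (h ℕ.+ H)) * ĉ t)
        split-weight t = begin
          (ζ ^ t) ^ (N ℕ.∸ h) * ĉ t
            ≡⟨ ≡.cong (λ n → (ζ ^ t) ^ n * ĉ t) (∸-split {N} {h} {H} (ℕ.<⇒≤ h+H<N)) ⟩
          (ζ ^ t) ^ (N ℕ.∸ (h ℕ.+ H) ℕ.+ H) * ĉ t              ≈⟨ *-congʳ (^-homo-* (ζ ^ t) (N ℕ.∸ (h ℕ.+ H)) H) ⟩
          ((ζ ^ t) ^ (N ℕ.∸ (h ℕ.+ H)) * (ζ ^ t) ^ H) * ĉ t    ≈⟨ *-assoc _ _ _ ⟩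
          (ζ ^ t) ^ (N ℕ.∸ (h ℕ.+ H)) * ((ζ ^ t) ^ H * ĉ t)    ≈⟨ *-congˡ (ζ^[tN/2]*ĉ≈-ĉ t) ⟩
          (ζ ^ t) ^ (N ℕ.∸ (h ℕ.+ H)) * - ĉ t                  ≈⟨ -‿distribʳ-* _ _ ⟨
          - ((ζ ^ t) ^ (N ℕ.∸ (h ℕ.+ H)) * ĉ t)                ∎

      criterion-from-half : (∀ h → h < H → criterion K m N a h ≈ 0#) → ∀ h → h < N → criterion K m N a h ≈ 0#
      criterion-from-half half h h<N with h ℕ.<? H
      ... | yes h<H = half h h<H
      ... | no  h≮H = ≡.subst (λ n → criterion K m N a n ≈ 0#) (ℕ.m∸n+n≡m H≤h) (cancel N≉0 (begin
          ofℕ K N * criterion K m N a (h ℕ.∸ H ℕ.+ H)      ≈⟨ -‿involutive _ ⟨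
          - - (ofℕ K N * criterion K m N a (h ℕ.∸ H ℕ.+ H)) ≈⟨ -‿cong (criterion-antiperiodic (h ℕ.∸ H) h-H+H<N) ⟨
          - (ofℕ K N * criterion K m N a (h ℕ.∸ H))         ≈⟨ -‿cong (*-congˡ (half (h ℕ.∸ H) h-H<H)) ⟩
          - (ofℕ K N * 0#)                                  ≈⟨ -‿cong (zeroʳ _) ⟩
          - 0#                                              ≈⟨ -0#≈0# ⟩
          0#                                                ∎))
        where
        H≤h : H ≤ h
        H≤h = ℕ.≮⇒≥ h≮H
        h-H+H<N : h ℕ.∸ H ℕ.+ H < N
        h-H+H<N = ≡.subst (_< N) (≡.sym (ℕ.m∸n+n≡m H≤h)) h<N
        h-H<H : h ℕ.∸ H < H
        h-H<H = ℕ.+-cancelʳ-< H (h ℕ.∸ H) H (≡.subst (h ℕ.∸ H ℕ.+ H <_) (≡.sym ([n/2]+[n/2]≡n 2∣N)) h-H+H<N)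

theorem1p1 : ∀ {c ℓ} (K : CommutativeRing c ℓ) → IsCharZeroField K →
  (m : ℕ) (a : Fin (suc m) → CommutativeRing.Carrier K) →
  ¬ (CommutativeRing._≈_ K (a zero) (CommutativeRing.0# K)) →
  (N : ℕ) .{{_ : NonZero N}} → φ N ≤ m →
  (ζ : CommutativeRing.Carrier K) → IsPrimitiveRoot K N ζ →
  ((_∣P_ K (cyclotomic K N ζ) (polyOf K m a))
     ⇔ (∀ h → h < N → CommutativeRing._≈_ K (criterion K m N a h) (CommutativeRing.0# K)))
  × (2 ∣ N → (∀ h → h < N / 2 → CommutativeRing._≈_ K (criterion K m N a h) (CommutativeRing.0# K))
       → _∣P_ K (cyclotomic K N ζ) (polyOf K m a))
theorem1p1 K F m a _ N _ ζ prim =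
    ⇔-trans cyclotomic-∣P⇔roots (⇔-trans roots⇔reciprocalVanishes (⇔-sym criterion⇔reciprocalVanishes))
  , λ 2∣N half → Equivalence.from cyclotomic-∣P⇔roots (Equivalence.from roots⇔reciprocalVanishes
      (Equivalence.to criterion⇔reciprocalVanishes (criterion-from-half 2∣N half)))
  where open Criterion K m a N
        open WithPrimitiveRoot F ζ prim
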